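{- Let $p$ be an odd prime, $d\ge3$ a divisor of $p-1$, and $m=(p-1)/d$. Then the third Viète coefficient of the degree-$d$ Gauss period polynomial is \[ a_3(p,d)=\begin{cases} p\,A_d-\frac{1}{3}\binom{d-1}{2}m^2, & d\equiv1\pmod 3,\\ p\,A_d-\frac{1}{3}\binom{d-1}{2}m^2, & d\equiv2\pmod 3,\\ p\,A_d-\frac13\Big[\binom{d-1}{2}-1\Big]m^2+\frac13\big[p\,B_d-m^2\big], & d\equiv0\pmod3.\end{cases} \]
   Context: Fix a primitive root $g$ mod $p$; $C_j=\{g^{id+j}:i=0,\dots,m-1\}$ for $j$ mod $d$; $\zeta$ a primitive complex $p$-th root of unity; $\eta_j=\sum_{x\in C_j}\zeta^x$. The coefficients $a_k(p,d)$ are defined by $\prod_{j=0}^{d-1}(X-\eta_j)=X^d+\sum_{k=1}^d(-1)^ka_k(p,d)X^{d-k}$ (so $a_3$ is the third elementary symmetric function of the $\eta_j$). For $0<a<b\le d-1$ let $z(0ab)$ be the Gauss symbol $\{\{1\},C_a,C_b\}=\#\{(x,y)\in C_a\times C_b: 1+x+y=0 \text{ in } \mathbf{F}_p\}$. Define $A_d=\sum z(0\,i\,(i+j))$, the sum over all integer pairs $(i,j)$ with $1\le i\le j\le d-2i-1$ (explicitly $A_d=z(012)+z(013)+\cdots+z(01(d-2))+z(024)+\cdots+z(02(d-3))+\cdots$), and, when $3\mid d$, $B_d=z(0\,\tfrac d3\,\tfrac{2d}3)$. -}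

module Defs where

open import Data.Nat as ℕ using (ℕ; zero; suc; _∸_; _<_; _≤_; _^_)
open import Data.Nat.DivMod using (_%_; _/_)
open import Data.Nat.Combinatorics using (_C_)
open import Data.Integer as ℤ using (ℤ; +_)
open import Data.Bool using (Bool; true; false; if_then_else_)
open import Data.List using (List; upTo; map)
open import Data.Product using (Σ; _×_)
open import Relation.Nullary using (¬_)
open import Relation.Nullary.Decidable using (⌊_⌋)
open import Relation.Binary.PropositionalEquality using (_≡_)

-- Total versions of mod / div (the modulus is always nonzero in use).

modN : ℕ → ℕ → ℕ
modN zero    x = x
modN (suc k) x = x % suc k

divN : ℕ → ℕ → ℕ
divN x zero    = 0
divN x (suc k) = x / suc k

Σℕ : ℕ → (ℕ → ℕ) → ℕ
Σℕ zero    f = 0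
Σℕ (suc n) f = Σℕ n f ℕ.+ f n

Σℤ : ℕ → (ℕ → ℤ) → ℤ
Σℤ zero    f = + 0
Σℤ (suc n) f = Σℤ n f ℤ.+ f n

Σlist : List ℕ → (ℕ → ℕ) → ℕ
Σlist List.[] f = 0
Σlist (x List.∷ xs) f = f x ℕ.+ Σlist xs f

[_] : Bool → ℕ
[ true ]  = 1
[ false ] = 0

IsPrimitiveRoot : ℕ → ℕ → Set
IsPrimitiveRoot p g =
  (modN p (g ^ (p ∸ 1)) ≡ 1) × (∀ k → 0 < k → k < p ∸ 1 → ¬ (modN p (g ^ k) ≡ 1))

mOf : ℕ → ℕ → ℕ
mOf p d = divN (p ∸ 1) d

Cls : (p d g j : ℕ) → List ℕ
Cls p d g j = map (λ i → modN p (g ^ (i ℕ.* d ℕ.+ j))) (upTo (mOf p d))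

z : (p d g a b : ℕ) → ℕ
z p d g a b =
  Σlist (Cls p d g a) λ x → Σlist (Cls p d g b) λ y →
    [ ⌊ modN p (1 ℕ.+ x ℕ.+ y) ℕ.≟ 0 ⌋ ]

A : (p d g : ℕ) → ℕ
A p d g = Σℕ d λ i → Σℕ d λ j →
  [ ⌊ 1 ℕ.≤? i ⌋ ] ℕ.* [ ⌊ i ℕ.≤? j ⌋ ] ℕ.* [ ⌊ j ℕ.+ 2 ℕ.* i ℕ.+ 1 ℕ.≤? d ⌋ ]
    ℕ.* z p d g i (i ℕ.+ j)

-- B_d = z(0, d/3, 2d/3)   (used only when 3 ∣ d)
B : (p d g : ℕ) → ℕ
B p d g = z p d g (divN d 3) (2 ℕ.* divN d 3)

-- The ring ℤ[ζ], ζ a primitive p-th root of unity, modelled as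
-- ℤ[x]/(x^p - 1) (elements: coefficient functions, only indices < p
-- matter) modulo the kernel of x ↦ ζ, which is ℤ·(1 + x + … + x^(p-1)).

GR : Set
GR = ℕ → ℤ

mul : ℕ → GR → GR → GR
mul p f g k = Σℤ p λ i → Σℤ p λ j →
  (if ⌊ modN p (i ℕ.+ j) ℕ.≟ k ⌋ then f i ℤ.* g j else + 0)

const : ℤ → GR
const c k = if ⌊ k ℕ.≟ 0 ⌋ then c else + 0

scale : ℤ → GR → GR
scale c f k = c ℤ.* f k

_≈[_]_ : GR → ℕ → GR → Set
f ≈[ p ] g = Σ ℤ λ c → ∀ k → k < p → f k ℤ.- g k ≡ c

η : (p d g j : ℕ) → GR
η p d g j k = + Σlist (Cls p d g j) (λ x → [ ⌊ x ℕ.≟ k ⌋ ])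

e3 : (p d g : ℕ) → GR
e3 p d g k = Σℤ d λ a → Σℤ d λ b → Σℤ d λ c →
  (if ⌊ a ℕ.<? b ⌋ Data.Bool.∧ ⌊ b ℕ.<? c ⌋
   then mul p (mul p (η p d g a) (η p d g b)) (η p d g c) k
   else + 0)

module Submission where

-- Multiplying out, the coefficient of x^k in e3 is E3 k = Σ_{a<b<c<d} N a b c k,
-- where N a b c k counts the x ∈ C_a, y ∈ C_b, w ∈ C_c with x + y + w ≡ k.
--  (i)   E3 k is the same for every k ≠ 0: multiplication by the primitive
--        root g permutes the nonzero residues and rotates the classes.
--  (ii)  Summing over all k: E3 0 + (p - 1) E3 1 = #{a<b<c<d} · m³.
--  (iii) Dividing by the element of C_a reduces N a b c 0 to m·z(0, b-a, c-a);
--        grouping triples by the rotation class of their gap pattern gives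
--        3 E3 0 = d m (3 A_d + B), with B = B_d if 3 ∣ d and B = 0 otherwise.
-- Hence 3 e3 is the constant 3 E3 0 - 3 E3 1, which (i)–(iii) and
-- 3·#{a<b<c<d} = d·C(d-1,2) determine.

open import Defs
open import Data.Nat using (ℕ; _∸_; _≤_; _*_; _+_)
open import Data.Nat.DivMod using (_%_)
open import Data.Nat.Divisibility using (_∣_)
open import Data.Nat.Primality using (Prime)
open import Data.Nat.Combinatorics using (_C_)
open import Data.Integer as ℤ using (+_)
open import Data.Product using (_×_)
open import Relation.Binary.PropositionalEquality using (_≡_)

open import Data.Nat
open import Data.Nat.Properties
open import Data.Nat.DivMod
open import Data.Nat.Divisibility using (divides)
open import Data.Nat.Combinatorics using (nC1≡n; nCk+nC[k+1]≡[n+1]C[k+1]; k>n⇒nCk≡0)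
open import Data.Nat.Tactic.RingSolver using (solve-∀)
open import Data.Integer using (ℤ)
import Data.Integer.Properties as ℤP
import Data.Integer.Tactic.RingSolver as ℤSolver
open import Data.Bool using (true; false; if_then_else_; _∧_; not)
open import Data.List using (upTo; map; applyUpTo)
open import Data.Empty using (⊥; ⊥-elim)
open import Data.Product using (Σ; _,_; ∃; proj₁; proj₂)
open import Data.Sum using (inj₁; inj₂)
open import Data.Fin as Fin using (Fin; toℕ; fromℕ<)
import Data.Fin.Properties as FinP
open import Function using (id)
open import Relation.Nullary using (¬_; yes; no; Dec)
open import Relation.Nullary.Decidable using (⌊_⌋; isYes≗does; dec-true; dec-false; does-⇔)
open import Function.Bundles using (mk⇔)
open import Relation.Binary.PropositionalEquality hiding ([_])

open ≡-Reasoning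

⌊⌋-true : ∀ {A : Set} (x : Dec A) → A → ⌊ x ⌋ ≡ true
⌊⌋-true x a = trans (isYes≗does x) (dec-true x a)

⌊⌋-false : ∀ {A : Set} (x : Dec A) → ¬ A → ⌊ x ⌋ ≡ false
⌊⌋-false x ¬a = trans (isYes≗does x) (dec-false x ¬a)

⌊⌋-⇔ : ∀ {A B : Set} (x : Dec A) (y : Dec B) → (A → B) → (B → A) → ⌊ x ⌋ ≡ ⌊ y ⌋
⌊⌋-⇔ x y f g = trans (isYes≗does x) (trans (does-⇔ (mk⇔ f g) x y) (sym (isYes≗does y)))

Σ-cong : ∀ n {f h : ℕ → ℕ} → (∀ i → i < n → f i ≡ h i) → Σℕ n f ≡ Σℕ n h
Σ-cong zero    eq = refl
Σ-cong (suc n) eq = cong₂ _+_ (Σ-cong n (λ i i<n → eq i (m<n⇒m<1+n i<n))) (eq n ≤-refl)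

Σ-ext : ∀ n {f h : ℕ → ℕ} → (∀ i → f i ≡ h i) → Σℕ n f ≡ Σℕ n h
Σ-ext n eq = Σ-cong n (λ i _ → eq i)

Σ-+ : ∀ n (f h : ℕ → ℕ) → Σℕ n (λ i → f i + h i) ≡ Σℕ n f + Σℕ n h
Σ-+ zero    f h = refl
Σ-+ (suc n) f h = begin
  Σℕ n (λ i → f i + h i) + (f n + h n) ≡⟨ cong (_+ (f n + h n)) (Σ-+ n f h) ⟩
  Σℕ n f + Σℕ n h + (f n + h n)        ≡⟨ interchange (Σℕ n f) (Σℕ n h) (f n) (h n) ⟩
  Σℕ n f + f n + (Σℕ n h + h n)        ∎
  where
  interchange : ∀ a b c e → a + b + (c + e) ≡ a + c + (b + e)
  interchange = solve-∀

Σ-*ˡ : ∀ n c (f : ℕ → ℕ) → Σℕ n (λ i → c * f i) ≡ c * Σℕ n f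
Σ-*ˡ zero    c f = sym (*-zeroʳ c)
Σ-*ˡ (suc n) c f = trans (cong (_+ c * f n) (Σ-*ˡ n c f)) (sym (*-distribˡ-+ c (Σℕ n f) (f n)))

Σ-*ʳ : ∀ n c (f : ℕ → ℕ) → Σℕ n (λ i → f i * c) ≡ Σℕ n f * c
Σ-*ʳ n c f = trans (Σ-ext n (λ i → *-comm (f i) c)) (trans (Σ-*ˡ n c f) (*-comm c (Σℕ n f)))

Σ-zero : ∀ n → Σℕ n (λ _ → 0) ≡ 0
Σ-zero zero    = refl
Σ-zero (suc n) = trans (+-identityʳ _) (Σ-zero n)

Σ-const : ∀ n c → Σℕ n (λ _ → c) ≡ n * c
Σ-const zero    c = refl
Σ-const (suc n) c = trans (cong (_+ c) (Σ-const n c)) (+-comm (n * c) c)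

Σ-swap : ∀ n m (f : ℕ → ℕ → ℕ) →
  Σℕ n (λ i → Σℕ m (f i)) ≡ Σℕ m (λ j → Σℕ n (λ i → f i j))
Σ-swap zero    m f = sym (Σ-zero m)
Σ-swap (suc n) m f = trans (cong (_+ Σℕ m (f n)) (Σ-swap n m f)) (sym (Σ-+ m _ _))

Σ-head : ∀ n (f : ℕ → ℕ) → Σℕ (suc n) f ≡ f 0 + Σℕ n (λ i → f (suc i))
Σ-head zero    f = +-comm 0 (f 0)
Σ-head (suc n) f = trans (cong (_+ f (suc n)) (Σ-head n f)) (+-assoc (f 0) _ _)

Σ-pick : ∀ n v (h : ℕ → ℕ) → v < n → Σℕ n (λ i → [ ⌊ v ≟ i ⌋ ] * h i) ≡ h v
Σ-pick (suc n) v h v<1+n with v ≟ n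
... | yes refl = cong₂ _+_ (trans (Σ-cong n vanish) (Σ-zero n)) (*-identityˡ (h v))
  where
  vanish : ∀ i → i < v → [ ⌊ v ≟ i ⌋ ] * h i ≡ 0
  vanish i i<v with v ≟ i
  ... | yes refl = ⊥-elim (<-irrefl refl i<v)
  ... | no _     = refl
... | no v≢n = trans (+-identityʳ _) (Σ-pick n v h (≤∧≢⇒< (≤-pred v<1+n) v≢n))

Σ-pickʳ : ∀ n v (h : ℕ → ℕ) → v < n → Σℕ n (λ i → h i * [ ⌊ i ≟ v ⌋ ]) ≡ h v
Σ-pickʳ n v h v<n =
  trans (Σ-ext n (λ i → trans (*-comm (h i) _)
                             (cong (λ b → [ b ] * h i) (⌊⌋-⇔ (i ≟ v) (v ≟ i) sym sym))))
        (Σ-pick n v h v<n)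

Σlist-upTo : ∀ m (f h : ℕ → ℕ) → Σlist (map f (upTo m)) h ≡ Σℕ m (λ i → h (f i))
Σlist-upTo m f h = go m id
  where
  go : ∀ m (e : ℕ → ℕ) → Σlist (map f (applyUpTo e m)) h ≡ Σℕ m (λ i → h (f (e i)))
  go zero    e = refl
  go (suc m) e = trans (cong (λ t → h (f (e 0)) + t) (go m (λ i → e (suc i))))
                       (sym (Σ-head m (λ i → h (f (e i)))))

[m%n+o]%n≡[m+o]%n : ∀ m o n .{{_ : NonZero n}} → (m % n + o) % n ≡ (m + o) % n
[m%n+o]%n≡[m+o]%n m o n = begin
  (m % n + o) % n         ≡⟨ %-distribˡ-+ (m % n) o n ⟩
  (m % n % n + o % n) % n ≡⟨ cong (λ t → (t + o % n) % n) (m%n%n≡m%n m n) ⟩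
  (m % n + o % n) % n     ≡⟨ sym (%-distribˡ-+ m o n) ⟩
  (m + o) % n             ∎

[m%n*o]%n≡[m*o]%n : ∀ m o n .{{_ : NonZero n}} → (m % n * o) % n ≡ (m * o) % n
[m%n*o]%n≡[m*o]%n m o n = begin
  (m % n * o) % n         ≡⟨ %-distribˡ-* (m % n) o n ⟩
  (m % n % n * (o % n)) % n ≡⟨ cong (λ t → (t * (o % n)) % n) (m%n%n≡m%n m n) ⟩
  (m % n * (o % n)) % n   ≡⟨ sym (%-distribˡ-* m o n) ⟩
  (m * o) % n             ∎

[m*o%n]%n≡[m*o]%n : ∀ m o n .{{_ : NonZero n}} → (m * (o % n)) % n ≡ (m * o) % n
[m*o%n]%n≡[m*o]%n m o n = begin
  (m * (o % n)) % n ≡⟨ cong (_% n) (*-comm m (o % n)) ⟩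
  (o % n * m) % n   ≡⟨ [m%n*o]%n≡[m*o]%n o m n ⟩
  (o * m) % n       ≡⟨ cong (_% n) (*-comm o m) ⟩
  (m * o) % n       ∎

Σ-rotate : ∀ n .{{_ : NonZero n}} a (f : ℕ → ℕ) → Σℕ n (λ i → f ((i + a) % n)) ≡ Σℕ n f
Σ-rotate n@(suc n-1) zero f =
  Σ-cong n λ i i<n → cong f (trans (cong (_% n) (+-identityʳ i)) (m<n⇒m%n≡m i<n))
Σ-rotate n@(suc n-1) (suc a) f = begin
  Σℕ n (λ i → f ((i + suc a) % n))
    ≡⟨ Σ-ext n (λ i → cong f (trans (cong (_% n) (trans (+-suc i a) (+-comm 1 (i + a))))
                                    (sym ([m%n+o]%n≡[m+o]%n (i + a) 1 n)))) ⟩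
  Σℕ n (λ i → f (((i + a) % n + 1) % n)) ≡⟨ Σ-rotate n a (λ j → f ((j + 1) % n)) ⟩
  Σℕ n (λ j → f ((j + 1) % n))           ≡⟨ rotate-by-one ⟩
  Σℕ n f                                 ∎
  where
  rotate-by-one : Σℕ n (λ j → f ((j + 1) % n)) ≡ Σℕ n f
  rotate-by-one = begin
    Σℕ n-1 (λ i → f ((i + 1) % n)) + f ((n-1 + 1) % n)
      ≡⟨ cong₂ _+_ (Σ-cong n-1 λ i i<n-1 → cong f (trans (cong (_% n) (+-comm i 1))
                                                          (m<n⇒m%n≡m (s≤s i<n-1))))
                   (cong f (trans (cong (_% n) (+-comm n-1 1)) (n%n≡0 n))) ⟩
    Σℕ n-1 (λ i → f (suc i)) + f 0 ≡⟨ +-comm _ (f 0) ⟩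
    f 0 + Σℕ n-1 (λ i → f (suc i)) ≡⟨ sym (Σ-head n-1 f) ⟩
    Σℕ n f                         ∎

∸-cancelʳ-<′ : ∀ {m n o} → m ∸ o < n ∸ o → m < n
∸-cancelʳ-<′ {m} {n} {o} lt with m <? n
... | yes m<n = m<n
... | no m≮n  = ⊥-elim (<⇒≱ lt (∸-monoˡ-≤ o (≮⇒≥ m≮n)))

%-wrap : ∀ d .{{_ : NonZero d}} x → d ≤ x → x ∸ d < d → x % d ≡ x ∸ d
%-wrap d x d≤x x∸d<d = trans (sym (m≤n⇒[n∸m]%m≡n%m d≤x)) (m<n⇒m%n≡m x∸d<d)

module PowersMod (q g : ℕ) (g^q≡1 : g ^ q % suc q ≡ 1) where
  P : ℕ
  P = suc q

  gpow : ℕ → ℕ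
  gpow e = g ^ e % P

  gpow<P : ∀ e → gpow e < P
  gpow<P e = m%n<n (g ^ e) P

  gpow-+ : ∀ a b → (gpow a * gpow b) % P ≡ gpow (a + b)
  gpow-+ a b = begin
    (g ^ a % P * (g ^ b % P)) % P ≡⟨ [m%n*o]%n≡[m*o]%n (g ^ a) _ P ⟩
    (g ^ a * (g ^ b % P)) % P     ≡⟨ [m*o%n]%n≡[m*o]%n (g ^ a) _ P ⟩
    (g ^ a * g ^ b) % P           ≡⟨ cong (_% P) (sym (^-distribˡ-+-* g a b)) ⟩
    gpow (a + b)                  ∎

  gpow-period : ∀ k x → gpow (k * q + x) ≡ gpow x
  gpow-period zero    x = refl
  gpow-period (suc k) x = begin
    gpow (q + k * q + x)          ≡⟨ cong gpow (+-assoc q (k * q) x) ⟩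
    gpow (q + (k * q + x))        ≡⟨ sym (gpow-+ q (k * q + x)) ⟩
    (gpow q * gpow (k * q + x)) % P ≡⟨ cong (λ t → (t * gpow (k * q + x)) % P) g^q≡1 ⟩
    (1 * gpow (k * q + x)) % P    ≡⟨ cong (_% P) (*-identityˡ (gpow (k * q + x))) ⟩
    gpow (k * q + x) % P          ≡⟨ m%n%n≡m%n (g ^ (k * q + x)) P ⟩
    gpow (k * q + x)              ≡⟨ gpow-period k x ⟩
    gpow x                        ∎

  gpow-inverse : ∀ e → e ≤ q → (gpow (q ∸ e) * gpow e) % P ≡ 1
  gpow-inverse e e≤q = trans (gpow-+ (q ∸ e) e) (trans (cong gpow (m∸n+n≡m e≤q)) g^q≡1)

  gpow-cancel : ∀ e r k → e ≤ q → r < P → k < P → (gpow e * r) % P ≡ (gpow e * k) % P → r ≡ k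
  gpow-cancel e r k e≤q r<P k<P eq = begin
    r                              ≡⟨ sym (undo r r<P) ⟩
    (u * ((gpow e * r) % P)) % P   ≡⟨ cong (λ t → (u * t) % P) eq ⟩
    (u * ((gpow e * k) % P)) % P   ≡⟨ undo k k<P ⟩
    k                              ∎
    where
    u = gpow (q ∸ e)
    undo : ∀ x → x < P → (u * ((gpow e * x) % P)) % P ≡ x
    undo x x<P = begin
      (u * ((gpow e * x) % P)) % P ≡⟨ [m*o%n]%n≡[m*o]%n u (gpow e * x) P ⟩
      (u * (gpow e * x)) % P       ≡⟨ cong (_% P) (sym (*-assoc u (gpow e) x)) ⟩
      (u * gpow e * x) % P         ≡⟨ sym ([m%n*o]%n≡[m*o]%n (u * gpow e) x P) ⟩
      ((u * gpow e) % P * x) % P   ≡⟨ cong (λ t → (t * x) % P) (gpow-inverse e e≤q) ⟩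
      (1 * x) % P                  ≡⟨ cong (_% P) (*-identityˡ x) ⟩
      x % P                        ≡⟨ m<n⇒m%n≡m x<P ⟩
      x                            ∎

  ≟-scale : ∀ e r k → e ≤ q → r < P → k < P →
    [ ⌊ (gpow e * r) % P ≟ (gpow e * k) % P ⌋ ] ≡ [ ⌊ r ≟ k ⌋ ]
  ≟-scale e r k e≤q r<P k<P with r ≟ k | (gpow e * r) % P ≟ (gpow e * k) % P
  ... | yes refl | yes _  = refl
  ... | yes refl | no ne  = ⊥-elim (ne refl)
  ... | no r≢k   | yes eq = ⊥-elim (r≢k (gpow-cancel e r k e≤q r<P k<P eq))
  ... | no _     | no _   = refl

  sum3 : ℕ → ℕ → ℕ → ℕ
  sum3 x y w = (x + y + w) % P

  sum3-scale : ∀ e x y w →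
    sum3 ((gpow e * x) % P) ((gpow e * y) % P) ((gpow e * w) % P) ≡ (gpow e * sum3 x y w) % P
  sum3-scale e x y w = begin
    (ex % P + ey % P + ew % P) % P     ≡⟨ %-distribˡ-+ (ex % P + ey % P) (ew % P) P ⟩
    ((ex % P + ey % P) % P + ew % P % P) % P
      ≡⟨ cong₂ (λ a b → (a + b) % P) (sym (%-distribˡ-+ ex ey P)) (m%n%n≡m%n ew P) ⟩
    ((ex + ey) % P + ew % P) % P       ≡⟨ sym (%-distribˡ-+ (ex + ey) ew P) ⟩
    (ex + ey + ew) % P                 ≡⟨ cong (_% P) (sym (*-distrib3 (gpow e) x y w)) ⟩
    (gpow e * (x + y + w)) % P         ≡⟨ sym ([m*o%n]%n≡[m*o]%n (gpow e) (x + y + w) P) ⟩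
    (gpow e * sum3 x y w) % P          ∎
    where
    ex = gpow e * x
    ey = gpow e * y
    ew = gpow e * w
    *-distrib3 : ∀ a x y w → a * (x + y + w) ≡ a * x + a * y + a * w
    *-distrib3 = solve-∀

module Classes (q g d m : ℕ) {{_ : NonZero d}} {{_ : NonZero m}}
               (g^q≡1 : g ^ q % suc q ≡ 1) (q≡md : q ≡ m * d) where
  open PowersMod q g g^q≡1 public

  cls : ℕ → ℕ → ℕ
  cls a s = gpow (s * d + a)

  -- The classes are indexed by ℤ/d: C_(a+d) = C_a, seen as a rotation of
  -- the enumeration index s.
  Σcls-period : ∀ a (φ : ℕ → ℕ) → Σℕ m (λ s → φ (cls (a + d) s)) ≡ Σℕ m (λ s → φ (cls a s))
  Σcls-period a φ = begin
    Σℕ m (λ s → φ (cls (a + d) s))          ≡⟨ Σ-ext m (λ s → cong φ (next s)) ⟩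
    Σℕ m (λ s → φ (cls a ((s + 1) % m)))    ≡⟨ Σ-rotate m 1 (λ s → φ (cls a s)) ⟩
    Σℕ m (λ s → φ (cls a s))                ∎
    where
    index : ∀ s → s * d + (a + d) ≡ (s + 1) / m * q + ((s + 1) % m * d + a)
    index s = begin
      s * d + (a + d)                 ≡⟨ shuffle s d a ⟩
      (s + 1) * d + a                 ≡⟨ cong (λ t → t * d + a) (m≡m%n+[m/n]*n (s + 1) m) ⟩
      ((s + 1) % m + (s + 1) / m * m) * d + a ≡⟨ regroup ((s + 1) % m) ((s + 1) / m) m d a ⟩
      (s + 1) / m * (m * d) + ((s + 1) % m * d + a) ≡⟨ cong (λ t → (s + 1) / m * t + _) (sym q≡md) ⟩
      (s + 1) / m * q + ((s + 1) % m * d + a) ∎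
      where
      shuffle : ∀ s d a → s * d + (a + d) ≡ (s + 1) * d + a
      shuffle = solve-∀
      regroup : ∀ r k m d a → (r + k * m) * d + a ≡ k * (m * d) + (r * d + a)
      regroup = solve-∀
    next : ∀ s → cls (a + d) s ≡ cls a ((s + 1) % m)
    next s = trans (cong gpow (index s)) (gpow-period ((s + 1) / m) _)

  Σcls-periodᵏ : ∀ k a (φ : ℕ → ℕ) → Σℕ m (λ s → φ (cls (a + k * d) s)) ≡ Σℕ m (λ s → φ (cls a s))
  Σcls-periodᵏ zero    a φ = Σ-ext m (λ s → cong (λ t → φ (cls t s)) (+-identityʳ a))
  Σcls-periodᵏ (suc k) a φ = begin
    Σℕ m (λ s → φ (cls (a + (d + k * d)) s))
      ≡⟨ Σ-ext m (λ s → cong (λ t → φ (cls t s)) (assoc-comm a d (k * d))) ⟩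
    Σℕ m (λ s → φ (cls (a + k * d + d) s)) ≡⟨ Σcls-period (a + k * d) φ ⟩
    Σℕ m (λ s → φ (cls (a + k * d) s))     ≡⟨ Σcls-periodᵏ k a φ ⟩
    Σℕ m (λ s → φ (cls a s))               ∎
    where
    assoc-comm : ∀ a d e → a + (d + e) ≡ a + e + d
    assoc-comm = solve-∀

  Σcls-mod : ∀ a (φ : ℕ → ℕ) → Σℕ m (λ s → φ (cls (a % d) s)) ≡ Σℕ m (λ s → φ (cls a s))
  Σcls-mod a φ = trans (sym (Σcls-periodᵏ (a / d) (a % d) φ))
    (Σ-ext m (λ s → cong (λ t → φ (cls t s)) (sym (m≡m%n+[m/n]*n a d))))

  cls-scale : ∀ e a s → (gpow e * cls a s) % P ≡ cls (a + e) s
  cls-scale e a s = trans (gpow-+ e (s * d + a))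
    (cong gpow (trans (+-comm e (s * d + a)) (+-assoc (s * d) a e)))

  N₂ : ℕ → ℕ → ℕ → ℕ → ℕ
  N₂ x b c k = Σℕ m (λ t → Σℕ m (λ u → [ ⌊ sum3 x (cls b t) (cls c u) ≟ k ⌋ ]))

  N : ℕ → ℕ → ℕ → ℕ → ℕ
  N a b c k = Σℕ m (λ s → N₂ (cls a s) b c k)

  N₂-scale : ∀ e x b c k → e ≤ q → k < P →
    N₂ ((gpow e * x) % P) (b + e) (c + e) ((gpow e * k) % P) ≡ N₂ x b c k
  N₂-scale e x b c k e≤q k<P = Σ-ext m λ t → Σ-ext m λ u → begin
    [ ⌊ sum3 ((gpow e * x) % P) (cls (b + e) t) (cls (c + e) u) ≟ (gpow e * k) % P ⌋ ]
      ≡⟨ cong₂ (λ y w → [ ⌊ sum3 ((gpow e * x) % P) y w ≟ (gpow e * k) % P ⌋ ])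
               (sym (cls-scale e b t)) (sym (cls-scale e c u)) ⟩
    [ ⌊ sum3 ((gpow e * x) % P) ((gpow e * cls b t) % P) ((gpow e * cls c u) % P) ≟ (gpow e * k) % P ⌋ ]
      ≡⟨ cong (λ r → [ ⌊ r ≟ (gpow e * k) % P ⌋ ]) (sum3-scale e x (cls b t) (cls c u)) ⟩
    [ ⌊ (gpow e * sum3 x (cls b t) (cls c u)) % P ≟ (gpow e * k) % P ⌋ ]
      ≡⟨ ≟-scale e _ k e≤q (m%n<n (x + cls b t + cls c u) P) k<P ⟩
    [ ⌊ sum3 x (cls b t) (cls c u) ≟ k ⌋ ] ∎

  N₂-periodᵇ : ∀ k x b c r → N₂ x (b + k * d) c r ≡ N₂ x b c r
  N₂-periodᵇ k x b c r = Σcls-periodᵏ k b (λ y → Σℕ m (λ u → [ ⌊ sum3 x y (cls c u) ≟ r ⌋ ]))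

  N₂-periodᶜ : ∀ k x b c r → N₂ x b (c + k * d) r ≡ N₂ x b c r
  N₂-periodᶜ k x b c r = Σ-ext m λ t → Σcls-periodᵏ k c (λ w → [ ⌊ sum3 x (cls b t) w ≟ r ⌋ ])

  1≤q : 1 ≤ q
  1≤q = subst (1 ≤_) (sym q≡md) (*-mono-≤ {1} {m} {1} {d} (>-nonZero⁻¹ m) (>-nonZero⁻¹ d))

  N₂-shift : ∀ e e' b c → N₂ (gpow (e' + e)) (b + e) (c + e) 0 ≡ N₂ (gpow e') b c 0
  N₂-shift zero e' b c rewrite +-identityʳ e' | +-identityʳ b | +-identityʳ c = refl
  N₂-shift (suc e) e' b c = begin
    N₂ (gpow (e' + suc e)) (b + suc e) (c + suc e) 0
      ≡⟨ cong (λ x → N₂ x (b + suc e) (c + suc e) 0)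
              (trans (cong gpow (+-suc e' e)) (sym (gpow-+ 1 (e' + e)))) ⟩
    N₂ ((gpow 1 * gpow (e' + e)) % P) (b + suc e) (c + suc e) 0
      ≡⟨ cong₂ (λ y w → N₂ ((gpow 1 * gpow (e' + e)) % P) y w 0) (+-suc-comm b e) (+-suc-comm c e) ⟩
    N₂ ((gpow 1 * gpow (e' + e)) % P) (b + e + 1) (c + e + 1) 0
      ≡⟨ cong (N₂ ((gpow 1 * gpow (e' + e)) % P) (b + e + 1) (c + e + 1))
              (sym (cong (_% P) (*-zeroʳ (gpow 1)))) ⟩
    N₂ ((gpow 1 * gpow (e' + e)) % P) (b + e + 1) (c + e + 1) ((gpow 1 * 0) % P)
      ≡⟨ N₂-scale 1 (gpow (e' + e)) (b + e) (c + e) 0 1≤q (s≤s z≤n) ⟩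
    N₂ (gpow (e' + e)) (b + e) (c + e) 0 ≡⟨ N₂-shift e e' b c ⟩
    N₂ (gpow e') b c 0 ∎
    where
    +-suc-comm : ∀ b e → b + suc e ≡ b + e + 1
    +-suc-comm b e = trans (+-suc b e) (+-comm 1 (b + e))

  N-scale : ∀ a b c k → k < P → N (a + 1) (b + 1) (c + 1) ((gpow 1 * k) % P) ≡ N a b c k
  N-scale a b c k k<P = Σ-ext m λ s →
    trans (cong (λ x → N₂ x (b + 1) (c + 1) ((gpow 1 * k) % P)) (sym (cls-scale 1 a s)))
          (N₂-scale 1 (cls a s) b c k 1≤q k<P)

  N-shift : ∀ e a b c → N (a + e) (b + e) (c + e) 0 ≡ N a b c 0
  N-shift e a b c = Σ-ext m λ s →
    trans (cong (λ x → N₂ x (b + e) (c + e) 0) (cong gpow (sym (+-assoc (s * d) a e))))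
          (N₂-shift e (s * d + a) b c)

  N-mod₁ : ∀ a b c k → N (a % d) b c k ≡ N a b c k
  N-mod₁ a b c k = Σcls-mod a (λ x → N₂ x b c k)

  N-mod₂ : ∀ a b c k → N a (b % d) c k ≡ N a b c k
  N-mod₂ a b c k = Σ-ext m λ s → Σcls-mod b (λ y → Σℕ m (λ u → [ ⌊ sum3 (cls a s) y (cls c u) ≟ k ⌋ ]))

  N-mod₃ : ∀ a b c k → N a b (c % d) k ≡ N a b c k
  N-mod₃ a b c k = Σ-ext m λ s → Σ-ext m λ t → Σcls-mod c (λ w → [ ⌊ sum3 (cls a s) (cls b t) w ≟ k ⌋ ])

  N-swap₁₂ : ∀ a b c k → N a b c k ≡ N b a c k
  N-swap₁₂ a b c k = trans (Σ-swap m m _) (Σ-ext m λ t → Σ-ext m λ s → Σ-ext m λ u →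
    cong (λ r → [ ⌊ (r + cls c u) % P ≟ k ⌋ ]) (+-comm (cls a s) (cls b t)))

  N-swap₂₃ : ∀ a b c k → N a b c k ≡ N a c b k
  N-swap₂₃ a b c k = Σ-ext m λ s → trans (Σ-swap m m _) (Σ-ext m λ u → Σ-ext m λ t →
    cong (λ r → [ ⌊ r % P ≟ k ⌋ ]) (swap-last (cls a s) (cls b t) (cls c u)))
    where
    swap-last : ∀ x y w → x + y + w ≡ x + w + y
    swap-last = solve-∀

Σ3 : ℕ → (ℕ → ℕ → ℕ → ℕ) → ℕ
Σ3 d h = Σℕ d (λ a → Σℕ d (λ b → Σℕ d (λ c → h a b c)))

Σ3-cong : ∀ d {h h' : ℕ → ℕ → ℕ → ℕ} →
  (∀ a b c → a < d → b < d → c < d → h a b c ≡ h' a b c) → Σ3 d h ≡ Σ3 d h'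
Σ3-cong d eq = Σ-cong d λ a a<d → Σ-cong d λ b b<d → Σ-cong d λ c c<d → eq a b c a<d b<d c<d

Σ3-+ : ∀ d (h h' : ℕ → ℕ → ℕ → ℕ) → Σ3 d (λ a b c → h a b c + h' a b c) ≡ Σ3 d h + Σ3 d h'
Σ3-+ d h h' = trans (Σ-ext d λ a → trans (Σ-ext d λ b → Σ-+ d (h a b) (h' a b)) (Σ-+ d _ _)) (Σ-+ d _ _)

Σ3-*ˡ : ∀ d k (h : ℕ → ℕ → ℕ → ℕ) → Σ3 d (λ a b c → k * h a b c) ≡ k * Σ3 d h
Σ3-*ˡ d k h = trans (Σ-ext d λ a → trans (Σ-ext d λ b → Σ-*ˡ d k (h a b)) (Σ-*ˡ d k _)) (Σ-*ˡ d k _)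

Σ3-swap₁₂ : ∀ d (h : ℕ → ℕ → ℕ → ℕ) → Σ3 d h ≡ Σ3 d (λ a b c → h b a c)
Σ3-swap₁₂ d h = Σ-swap d d _

Σ3-swap₂₃ : ∀ d (h : ℕ → ℕ → ℕ → ℕ) → Σ3 d h ≡ Σ3 d (λ a b c → h a c b)
Σ3-swap₂₃ d h = Σ-ext d λ a → Σ-swap d d _

Σ3-cycle : ∀ d (h : ℕ → ℕ → ℕ → ℕ) → Σ3 d h ≡ Σ3 d (λ a b c → h c a b)
Σ3-cycle d h = trans (Σ3-swap₁₂ d h) (Σ3-swap₂₃ d (λ a b c → h b a c))

Σ3-cycle² : ∀ d (h : ℕ → ℕ → ℕ → ℕ) → Σ3 d h ≡ Σ3 d (λ a b c → h b c a)
Σ3-cycle² d h = trans (Σ3-cycle d h) (Σ3-cycle d (λ a b c → h c a b))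

Σ3-rotate : ∀ d .{{_ : NonZero d}} e (h : ℕ → ℕ → ℕ → ℕ) →
  Σ3 d (λ a b c → h ((a + e) % d) ((b + e) % d) ((c + e) % d)) ≡ Σ3 d h
Σ3-rotate d e h = begin
  Σ3 d (λ a b c → h ((a + e) % d) ((b + e) % d) ((c + e) % d))
    ≡⟨ Σ-ext d (λ a → Σ-ext d λ b → Σ-rotate d e (h ((a + e) % d) ((b + e) % d))) ⟩
  Σℕ d (λ a → Σℕ d λ b → Σℕ d (h ((a + e) % d) ((b + e) % d)))
    ≡⟨ Σ-ext d (λ a → Σ-rotate d e (λ b → Σℕ d (h ((a + e) % d) b))) ⟩
  Σℕ d (λ a → Σℕ d λ b → Σℕ d (h ((a + e) % d) b))
    ≡⟨ Σ-rotate d e (λ a → Σℕ d λ b → Σℕ d (h a b)) ⟩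
  Σ3 d h ∎

Σ3-relative : ∀ d .{{_ : NonZero d}} (h : ℕ → ℕ → ℕ → ℕ) →
  Σ3 d h ≡ Σ3 d (λ a b c → h a ((b + a) % d) ((c + a) % d))
Σ3-relative d h = Σ-ext d λ a → sym
  (trans (Σ-ext d λ b → Σ-rotate d a (h a ((b + a) % d))) (Σ-rotate d a (λ b → Σℕ d (h a b))))

lt : ℕ → ℕ → ℕ
lt x y = [ ⌊ x <? y ⌋ ]

ord : ℕ → ℕ → ℕ → ℕ
ord a b c = [ ⌊ a <? b ⌋ ∧ ⌊ b <? c ⌋ ]

ne : ℕ → ℕ → ℕ
ne x y = [ not ⌊ x ≟ y ⌋ ]

distinct : ℕ → ℕ → ℕ → ℕ
distinct a b c = ne a b * ne a c * ne b c

ne-split : ∀ x y → ne x y ≡ lt x y + lt y x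
ne-split x y with x <? y | y <? x | x ≟ y
... | yes x<y | yes y<x | _       = ⊥-elim (<-asym x<y y<x)
... | yes x<y | no _    | yes refl = ⊥-elim (<-irrefl refl x<y)
... | yes _   | no _    | no _    = refl
... | no _    | yes y<x | yes refl = ⊥-elim (<-irrefl refl y<x)
... | no _    | yes _   | no _    = refl
... | no _    | no _    | yes _   = refl
... | no x≮y  | no y≮x  | no x≢y  = ⊥-elim (y≮x (≤∧≢⇒< (≮⇒≥ x≮y) (λ y≡x → x≢y (sym y≡x))))

lt-chain : ∀ x y z → lt x y * lt y z * lt x z ≡ ord x y z
lt-chain x y z with x <? y | y <? z
... | no _    | _       = refl
... | yes _   | no _    = refl
... | yes x<y | yes y<z with x <? z
...   | yes _   = refl
...   | no x≮z  = ⊥-elim (x≮z (<-trans x<y y<z))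

lt-cycle : ∀ x y z → lt x y * lt y z * lt z x ≡ 0
lt-cycle x y z with x <? y | y <? z
... | no _    | _       = refl
... | yes _   | no _    = refl
... | yes x<y | yes y<z with z <? x
...   | yes z<x = ⊥-elim (<-asym (<-trans x<y y<z) z<x)
...   | no _    = refl

distinct-orders : ∀ a b c →
  distinct a b c ≡ ord a b c + ord a c b + ord b a c + ord b c a + ord c a b + ord c b a
distinct-orders a b c = begin
  ne a b * ne a c * ne b c
    ≡⟨ cong₂ _*_ (cong₂ _*_ (ne-split a b) (ne-split a c)) (ne-split b c) ⟩
  (lt a b + lt b a) * (lt a c + lt c a) * (lt b c + lt c b)
    ≡⟨ expand (lt a b) (lt b a) (lt a c) (lt c a) (lt b c) (lt c b) ⟩
  (lt a b * lt b c * lt a c + lt a c * lt c b * lt a b + lt b a * lt a c * lt b c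
   + lt b c * lt c a * lt b a + lt c a * lt a b * lt c b + lt c b * lt b a * lt c a)
  + (lt a b * lt b c * lt c a + lt a c * lt c b * lt b a)
    ≡⟨ cong₂ _+_ (cong₂ _+_ (cong₂ _+_ (cong₂ _+_ (cong₂ _+_ (cong₂ _+_
         (lt-chain a b c) (lt-chain a c b)) (lt-chain b a c)) (lt-chain b c a))
         (lt-chain c a b)) (lt-chain c b a))
         (cong₂ _+_ (lt-cycle a b c) (lt-cycle a c b)) ⟩
  ord a b c + ord a c b + ord b a c + ord b c a + ord c a b + ord c b a + 0
    ≡⟨ +-identityʳ _ ⟩
  ord a b c + ord a c b + ord b a c + ord b c a + ord c a b + ord c b a ∎
  where
  expand : ∀ ab ba ac ca bc cb → (ab + ba) * (ac + ca) * (bc + cb) ≡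
    (ab * bc * ac + ac * cb * ab + ba * ac * bc + bc * ca * ba + ca * ab * cb + cb * ba * ca)
    + (ab * bc * ca + ac * cb * ba)
  expand = solve-∀

module SymmetricSum (d : ℕ) (F : ℕ → ℕ → ℕ → ℕ)
       (F-swap₁₂ : ∀ a b c → F a b c ≡ F b a c) (F-swap₂₃ : ∀ a b c → F a b c ≡ F a c b) where

  Σ-increasing : ℕ
  Σ-increasing = Σ3 d (λ a b c → ord a b c * F a b c)

  Σ-distinct : Σ3 d (λ a b c → distinct a b c * F a b c) ≡ 6 * Σ-increasing
  Σ-distinct = begin
    Σ3 d (λ a b c → distinct a b c * F a b c)
      ≡⟨ Σ3-cong d (λ a b c _ _ _ → trans (cong (_* F a b c) (distinct-orders a b c))
                                         (*-distrib6 (ord a b c) (ord a c b) (ord b a c) (ord b c a) (ord c a b) (ord c b a) (F a b c))) ⟩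
    Σ3 d (λ a b c → o₁ a b c + o₂ a b c + o₃ a b c + o₄ a b c + o₅ a b c + o₆ a b c)
      ≡⟨ Σ3-+6 ⟩
    Σ3 d o₁ + Σ3 d o₂ + Σ3 d o₃ + Σ3 d o₄ + Σ3 d o₅ + Σ3 d o₆
      ≡⟨ cong₂ _+_ (cong₂ _+_ (cong₂ _+_ (cong₂ _+_ (cong (λ t → Σ-increasing + t) acb) bac) bca) cab) cba ⟩
    Σ-increasing + Σ-increasing + Σ-increasing + Σ-increasing + Σ-increasing + Σ-increasing
      ≡⟨ six Σ-increasing ⟩
    6 * Σ-increasing ∎
    where
    o₁ o₂ o₃ o₄ o₅ o₆ : ℕ → ℕ → ℕ → ℕ
    o₁ a b c = ord a b c * F a b c
    o₂ a b c = ord a c b * F a b c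
    o₃ a b c = ord b a c * F a b c
    o₄ a b c = ord b c a * F a b c
    o₅ a b c = ord c a b * F a b c
    o₆ a b c = ord c b a * F a b c
    *-distrib6 : ∀ x₁ x₂ x₃ x₄ x₅ x₆ y →
      (x₁ + x₂ + x₃ + x₄ + x₅ + x₆) * y ≡ x₁ * y + x₂ * y + x₃ * y + x₄ * y + x₅ * y + x₆ * y
    *-distrib6 = solve-∀
    six : ∀ x → x + x + x + x + x + x ≡ 6 * x
    six = solve-∀
    Σ3-+6 : Σ3 d (λ a b c → o₁ a b c + o₂ a b c + o₃ a b c + o₄ a b c + o₅ a b c + o₆ a b c)
          ≡ Σ3 d o₁ + Σ3 d o₂ + Σ3 d o₃ + Σ3 d o₄ + Σ3 d o₅ + Σ3 d o₆
    Σ3-+6 = begin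
      _ ≡⟨ Σ3-+ d _ o₆ ⟩
      _ ≡⟨ cong (_+ Σ3 d o₆) (Σ3-+ d _ o₅) ⟩
      _ ≡⟨ cong (λ t → t + Σ3 d o₅ + Σ3 d o₆) (Σ3-+ d _ o₄) ⟩
      _ ≡⟨ cong (λ t → t + Σ3 d o₄ + Σ3 d o₅ + Σ3 d o₆) (Σ3-+ d _ o₃) ⟩
      _ ≡⟨ cong (λ t → t + Σ3 d o₃ + Σ3 d o₄ + Σ3 d o₅ + Σ3 d o₆) (Σ3-+ d o₁ o₂) ⟩
      _ ∎
    relabel : ∀ {o : ℕ → ℕ → ℕ → ℕ} → (∀ a b c → F a b c ≡ o a b c) →
              Σ3 d (λ a b c → ord a b c * o a b c) ≡ Σ-increasing
    relabel eq = Σ3-cong d λ a b c _ _ _ → cong (ord a b c *_) (sym (eq a b c))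
    acb : Σ3 d o₂ ≡ Σ-increasing
    acb = trans (Σ3-swap₂₃ d o₂) (relabel F-swap₂₃)
    bac : Σ3 d o₃ ≡ Σ-increasing
    bac = trans (Σ3-swap₁₂ d o₃) (relabel F-swap₁₂)
    bca : Σ3 d o₄ ≡ Σ-increasing
    bca = trans (Σ3-cycle d o₄) (relabel λ a b c → trans (F-swap₂₃ a b c) (F-swap₁₂ a c b))
    cab : Σ3 d o₅ ≡ Σ-increasing
    cab = trans (Σ3-cycle² d o₅) (relabel λ a b c → trans (F-swap₁₂ a b c) (F-swap₂₃ b a c))
    cba : Σ3 d o₆ ≡ Σ-increasing
    cba = trans (Σ3-cycle d o₆) (trans (Σ3-swap₁₂ d _)
            (relabel λ a b c → trans (F-swap₁₂ a b c) (trans (F-swap₂₃ b a c) (F-swap₁₂ b c a))))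

+1-mod-injective : ∀ d .{{_ : NonZero d}} x y → x < d → y < d → (x + 1) % d ≡ (y + 1) % d → x ≡ y
+1-mod-injective d@(suc d-1) x y x<d y<d eq =
  trans (sym (back x x<d)) (trans (cong (λ t → (t + d-1) % d) eq) (back y y<d))
  where
  back : ∀ x → x < d → ((x + 1) % d + d-1) % d ≡ x
  back x x<d = begin
    ((x + 1) % d + d-1) % d ≡⟨ [m%n+o]%n≡[m+o]%n (x + 1) d-1 d ⟩
    (x + 1 + d-1) % d       ≡⟨ cong (_% d) (+-assoc x 1 d-1) ⟩
    (x + d) % d             ≡⟨ [m+n]%n≡m%n x d ⟩
    x % d                   ≡⟨ m<n⇒m%n≡m x<d ⟩
    x                       ∎

distinct-rotate : ∀ d .{{_ : NonZero d}} a b c → a < d → b < d → c < d →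
  distinct ((a + 1) % d) ((b + 1) % d) ((c + 1) % d) ≡ distinct a b c
distinct-rotate d a b c a<d b<d c<d =
  cong₂ _*_ (cong₂ _*_ (ne-rotate a b a<d b<d) (ne-rotate a c a<d c<d)) (ne-rotate b c b<d c<d)
  where
  ne-rotate : ∀ x y → x < d → y < d → ne ((x + 1) % d) ((y + 1) % d) ≡ ne x y
  ne-rotate x y x<d y<d = cong (λ t → [ not t ])
    (⌊⌋-⇔ ((x + 1) % d ≟ (y + 1) % d) (x ≟ y)
          (+1-mod-injective d x y x<d y<d) (cong (λ t → (t + 1) % d)))

-- For 0 < B < C < d the
-- three gaps of {0, B, C} are (B, C - B, d - C), and `weight d B C`
-- selects one rotation of each gap pattern: it is 3 when B is the
-- leading gap (B ≤ C - B and B < d - C) and 1 for the balanced pattern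
-- B = d/3, C = 2d/3.  These are exactly the index sets of A_d and B_d.

δ : ℕ → ℕ → ℕ → ℕ
δ d x y = if ⌊ x ≤? y ⌋ then y ∸ x else d + y ∸ x

δ-≤ : ∀ d x y → x ≤ y → δ d x y ≡ y ∸ x
δ-≤ d x y x≤y rewrite ⌊⌋-true (x ≤? y) x≤y = refl

δ-> : ∀ d x y → y < x → δ d x y ≡ d + y ∸ x
δ-> d x y y<x rewrite ⌊⌋-false (x ≤? y) (<⇒≱ y<x) = refl

δ-relative : ∀ d .{{_ : NonZero d}} a b → a < d → b < d → δ d a ((b + a) % d) ≡ b
δ-relative d a b a<d b<d with b + a <? d
... | yes b+a<d = begin
  δ d a ((b + a) % d) ≡⟨ cong (δ d a) (m<n⇒m%n≡m b+a<d) ⟩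
  δ d a (b + a)       ≡⟨ δ-≤ d a (b + a) (m≤n+m a b) ⟩
  b + a ∸ a           ≡⟨ m+n∸n≡m b a ⟩
  b                   ∎
... | no b+a≮d = begin
  δ d a ((b + a) % d) ≡⟨ cong (δ d a) wrap ⟩
  δ d a r             ≡⟨ δ-> d a r r<a ⟩
  d + r ∸ a           ≡⟨ cong (_∸ a) (m+[n∸m]≡n d≤b+a) ⟩
  b + a ∸ a           ≡⟨ m+n∸n≡m b a ⟩
  b                   ∎
  where
  d≤b+a : d ≤ b + a
  d≤b+a = ≮⇒≥ b+a≮d
  r = b + a ∸ d
  r<a : r < a
  r<a = subst (r <_) (m+n∸n≡m a d)
          (∸-monoˡ-< (subst (_< a + d) (+-comm a b) (+-monoʳ-< a b<d)) d≤b+a)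
  r<d : r < d
  r<d = subst (r <_) (m+n∸m≡n d d) (∸-monoˡ-< (+-mono-< b<d a<d) d≤b+a)
  wrap : (b + a) % d ≡ r
  wrap = %-wrap d (b + a) d≤b+a r<d

weight : ℕ → ℕ → ℕ → ℕ
weight d B C = 3 * ([ ⌊ 1 ≤? B ⌋ ] * [ ⌊ 2 * B ≤? C ⌋ ] * [ ⌊ B + C <? d ⌋ ])
             + [ ⌊ 3 * B ≟ d ⌋ ] * [ ⌊ C ≟ 2 * B ⌋ ]

weightAt : ℕ → ℕ → ℕ → ℕ → ℕ
weightAt d a b c = weight d (δ d a b) (δ d a c)

weight3 : ℕ → ℕ → ℕ → ℕ → ℕ
weight3 d a b c = weightAt d a b c + weightAt d b c a + weightAt d c a b

lead : ℕ → ℕ → ℕ → ℕ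
lead x y z = 3 * ([ ⌊ x ≤? y ⌋ ] * [ ⌊ x <? z ⌋ ]) + [ ⌊ x ≟ y ⌋ ] * [ ⌊ x ≟ z ⌋ ]

lead-strict : ∀ x y z → x ≤ y → x < z → lead x y z ≡ 3
lead-strict x y z x≤y x<z with x ≤? y | x <? z | x ≟ z
... | no x≰y | _       | _        = ⊥-elim (x≰y x≤y)
... | _      | no x≮z  | _        = ⊥-elim (x≮z x<z)
... | _      | _       | yes refl = ⊥-elim (<-irrefl refl x<z)
... | yes _  | yes _   | no _     = cong (λ t → 3 + t) (*-zeroʳ [ ⌊ x ≟ y ⌋ ])

lead-tie : ∀ x → lead x x x ≡ 1
lead-tie x with x ≤? x | x <? x | x ≟ x
... | no x≰x | _       | _      = ⊥-elim (x≰x ≤-refl)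
... | _      | yes x<x | _      = ⊥-elim (<-irrefl refl x<x)
... | _      | _       | no x≢x = ⊥-elim (x≢x refl)
... | yes _  | no _    | yes _  = refl

lead-none : ∀ x y z → ¬ (x ≤ y × x < z) → ¬ (x ≡ y × x ≡ z) → lead x y z ≡ 0
lead-none x y z ¬leads ¬tie with x ≤? y | x <? z | x ≟ y | x ≟ z
... | yes x≤y | yes x<z | _     | _      = ⊥-elim (¬leads (x≤y , x<z))
... | _       | _       | yes e | yes f  = ⊥-elim (¬tie (e , f))
... | no _    | _       | no _  | _      = refl
... | no _    | _       | yes _ | no _   = refl
... | yes _   | no _    | no _  | _      = refl
... | yes _   | no _    | yes _ | no _   = refl

leads : ℕ → ℕ → ℕ → ℕ
leads x y z = lead x y z + lead y z x + lead z x y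

leads-rotate : ∀ x y z → leads x y z ≡ leads y z x
leads-rotate x y z = rotate (lead x y z) (lead y z x) (lead z x y)
  where
  rotate : ∀ u v w → u + v + w ≡ v + w + u
  rotate = solve-∀

leads-min : ∀ x y z → x ≤ y → x ≤ z → leads x y z ≡ 3
leads-min x y z x≤y x≤z with m≤n⇒m<n∨m≡n x≤y | m≤n⇒m<n∨m≡n x≤z
... | inj₁ x<y | inj₁ x<z = cong₂ _+_ (cong₂ _+_ (lead-strict x y z x≤y x<z)
        (lead-none y z x (λ (_ , y<x) → <-asym x<y y<x) (λ (_ , y≡x) → <-irrefl (sym y≡x) x<y)))
        (lead-none z x y (λ (z≤x , _) → <⇒≱ x<z z≤x) (λ (z≡x , _) → <-irrefl (sym z≡x) x<z))
... | inj₂ refl | inj₁ x<z = cong₂ _+_ (cong₂ _+_ (lead-strict x x z ≤-refl x<z)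
        (lead-none x z x (λ (_ , x<x) → <-irrefl refl x<x) (λ (x≡z , _) → <-irrefl x≡z x<z)))
        (lead-none z x x (λ (z≤x , _) → <⇒≱ x<z z≤x) (λ (z≡x , _) → <-irrefl (sym z≡x) x<z))
... | inj₁ x<y | inj₂ refl = cong₂ _+_ (cong₂ _+_
        (lead-none x y x (λ (_ , x<x) → <-irrefl refl x<x) (λ (x≡y , _) → <-irrefl x≡y x<y))
        (lead-none y x x (λ (y≤x , _) → <⇒≱ x<y y≤x) (λ (y≡x , _) → <-irrefl (sym y≡x) x<y)))
        (lead-strict x x y ≤-refl x<y)
... | inj₂ refl | inj₂ refl = cong₂ _+_ (cong₂ _+_ (lead-tie x) (lead-tie x)) (lead-tie x)

leads≡3 : ∀ x y z → leads x y z ≡ 3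
leads≡3 x y z with ≤-total x y | ≤-total x z
... | inj₁ x≤y | inj₁ x≤z = leads-min x y z x≤y x≤z
... | inj₁ x≤y | inj₂ z≤x = trans (leads-rotate x y z)
        (trans (leads-rotate y z x) (leads-min z x y z≤x (≤-trans z≤x x≤y)))
... | inj₂ y≤x | inj₁ x≤z = trans (leads-rotate x y z) (leads-min y z x (≤-trans y≤x x≤z) y≤x)
... | inj₂ y≤x | inj₂ z≤x with ≤-total y z
...   | inj₁ y≤z = trans (leads-rotate x y z) (leads-min y z x y≤z y≤x)
...   | inj₂ z≤y = trans (leads-rotate x y z) (trans (leads-rotate y z x) (leads-min z x y z≤x z≤y))

weight-lead : ∀ x y z → 1 ≤ x → weight (x + y + z) x (x + y) ≡ lead x y z
weight-lead x y z 1≤x = cong₂ (λ u v → 3 * u + v) leading balanced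
  where
  2x≡x+x : 2 * x ≡ x + x
  2x≡x+x = cong (λ t → x + t) (+-identityʳ x)
  second : ⌊ 2 * x ≤? x + y ⌋ ≡ ⌊ x ≤? y ⌋
  second = ⌊⌋-⇔ (2 * x ≤? x + y) (x ≤? y)
    (λ h → +-cancelˡ-≤ x x y (subst (_≤ x + y) 2x≡x+x h))
    (λ h → subst (_≤ x + y) (sym 2x≡x+x) (+-monoʳ-≤ x h))
  third : ⌊ x + (x + y) <? x + y + z ⌋ ≡ ⌊ x <? z ⌋
  third = ⌊⌋-⇔ (x + (x + y) <? x + y + z) (x <? z)
    (λ h → +-cancelˡ-< (x + y) x z (subst (_< x + y + z) (+-comm x (x + y)) h))
    (λ h → subst (_< x + y + z) (+-comm (x + y) x) (+-monoʳ-< (x + y) h))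
  leading : [ ⌊ 1 ≤? x ⌋ ] * [ ⌊ 2 * x ≤? x + y ⌋ ] * [ ⌊ x + (x + y) <? x + y + z ⌋ ]
          ≡ [ ⌊ x ≤? y ⌋ ] * [ ⌊ x <? z ⌋ ]
  leading rewrite ⌊⌋-true (1 ≤? x) 1≤x | second | third = cong (_* [ ⌊ x <? z ⌋ ]) (+-identityʳ [ ⌊ x ≤? y ⌋ ])
  balanced : [ ⌊ 3 * x ≟ x + y + z ⌋ ] * [ ⌊ x + y ≟ 2 * x ⌋ ] ≡ [ ⌊ x ≟ y ⌋ ] * [ ⌊ x ≟ z ⌋ ]
  balanced with x ≟ y
  ... | no x≢y = trans (cong (λ u → [ ⌊ 3 * x ≟ x + y + z ⌋ ] * [ u ])
                             (⌊⌋-false (x + y ≟ 2 * x) (λ h → x≢y (sym (+-cancelˡ-≡ x y x (trans h 2x≡x+x))))))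
                       (*-zeroʳ [ ⌊ 3 * x ≟ x + y + z ⌋ ])
  ... | yes refl = begin
    [ ⌊ 3 * x ≟ x + x + z ⌋ ] * [ ⌊ x + x ≟ 2 * x ⌋ ]
      ≡⟨ cong₂ (λ u v → [ u ] * [ v ])
               (⌊⌋-⇔ (3 * x ≟ x + x + z) (x ≟ z)
                     (λ h → +-cancelˡ-≡ (x + x) x z (trans (triple x) h))
                     (λ h → trans (sym (triple x)) (cong (λ t → x + x + t) h)))
               (⌊⌋-true (x + x ≟ 2 * x) (sym 2x≡x+x)) ⟩
    [ ⌊ x ≟ z ⌋ ] * 1 ≡⟨ *-identityʳ _ ⟩
    [ ⌊ x ≟ z ⌋ ]     ≡⟨ sym (+-identityʳ _) ⟩
    1 * [ ⌊ x ≟ z ⌋ ] ∎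
    where
    triple : ∀ x → x + x + x ≡ 3 * x
    triple = solve-∀

-- For points a < a + g₁ < a + g₁ + g₂ < d = a + g₁ + g₂ + w the three
-- rotations see the gaps (g₁, g₂, w + a) cyclically permuted.
weight3-gaps : ∀ a g₁ g₂ w → 1 ≤ g₁ → 1 ≤ g₂ → 1 ≤ w →
  weight3 (a + g₁ + g₂ + w) a (a + g₁) (a + g₁ + g₂) ≡ 3
weight3-gaps a g₁ g₂ w 1≤g₁ 1≤g₂ 1≤w = begin
  weight d (δ d a b) (δ d a c) + weight d (δ d b c) (δ d b a) + weight d (δ d c a) (δ d c b)
    ≡⟨ cong₂ _+_ (cong₂ _+_ (cong₂ (weight d) δab δac) (cong₂ (weight d) δbc δba))
                 (cong₂ (weight d) δca δcb) ⟩
  weight d g₁ (g₁ + g₂) + weight d g₂ (g₂ + g₃) + weight d g₃ (g₃ + g₁)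
    ≡⟨ cong₂ _+_ (cong₂ _+_ (cong (λ t → weight t g₁ (g₁ + g₂)) (circle a g₁ g₂ w))
                            (cong (λ t → weight t g₂ (g₂ + g₃)) (circle′ a g₁ g₂ w)))
                 (cong (λ t → weight t g₃ (g₃ + g₁)) (circle″ a g₁ g₂ w)) ⟩
  weight (g₁ + g₂ + g₃) g₁ (g₁ + g₂) + weight (g₂ + g₃ + g₁) g₂ (g₂ + g₃)
    + weight (g₃ + g₁ + g₂) g₃ (g₃ + g₁)
    ≡⟨ cong₂ _+_ (cong₂ _+_ (weight-lead g₁ g₂ g₃ 1≤g₁) (weight-lead g₂ g₃ g₁ 1≤g₂))
                 (weight-lead g₃ g₁ g₂ 1≤g₃) ⟩
  leads g₁ g₂ g₃ ≡⟨ leads≡3 g₁ g₂ g₃ ⟩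
  3 ∎
  where
  b = a + g₁
  c = a + g₁ + g₂
  d = a + g₁ + g₂ + w
  g₃ = w + a
  1≤g₃ : 1 ≤ g₃
  1≤g₃ = ≤-trans 1≤w (m≤m+n w a)
  circle circle′ circle″ : ∀ a g₁ g₂ w → a + g₁ + g₂ + w ≡ _
  circle = λ a g₁ g₂ w → solve₁ a g₁ g₂ w
    where solve₁ : ∀ a g₁ g₂ w → a + g₁ + g₂ + w ≡ g₁ + g₂ + (w + a)
          solve₁ = solve-∀
  circle′ = λ a g₁ g₂ w → solve₂ a g₁ g₂ w
    where solve₂ : ∀ a g₁ g₂ w → a + g₁ + g₂ + w ≡ g₂ + (w + a) + g₁
          solve₂ = solve-∀
  circle″ = λ a g₁ g₂ w → solve₃ a g₁ g₂ w
    where solve₃ : ∀ a g₁ g₂ w → a + g₁ + g₂ + w ≡ w + a + g₁ + g₂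
          solve₃ = solve-∀
  forward : ∀ x g → δ d x (x + g) ≡ g
  forward x g = trans (δ-≤ d x (x + g) (m≤m+n x g)) (m+n∸m≡n x g)
  backward : ∀ x y g → y < x → d + y ≡ x + g → δ d x y ≡ g
  backward x y g y<x e = trans (δ-> d x y y<x) (trans (cong (_∸ x) e) (m+n∸m≡n x g))
  δab : δ d a b ≡ g₁
  δab = forward a g₁
  δac : δ d a c ≡ g₁ + g₂
  δac = trans (cong (δ d a) (+-assoc a g₁ g₂)) (forward a (g₁ + g₂))
  δbc : δ d b c ≡ g₂
  δbc = forward b g₂
  a<b : a < b
  a<b = subst (_≤ b) (+-comm a 1) (+-monoʳ-≤ a 1≤g₁)
  b<c : b < c
  b<c = subst (_≤ c) (+-comm b 1) (+-monoʳ-≤ b 1≤g₂)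
  δba : δ d b a ≡ g₂ + g₃
  δba = backward b a (g₂ + g₃) a<b (shift₁ a g₁ g₂ w)
    where shift₁ : ∀ a g₁ g₂ w → a + g₁ + g₂ + w + a ≡ a + g₁ + (g₂ + (w + a))
          shift₁ = solve-∀
  δca : δ d c a ≡ g₃
  δca = backward c a g₃ (<-trans a<b b<c) (shift₂ a g₁ g₂ w)
    where shift₂ : ∀ a g₁ g₂ w → a + g₁ + g₂ + w + a ≡ a + g₁ + g₂ + (w + a)
          shift₂ = solve-∀
  δcb : δ d c b ≡ g₃ + g₁
  δcb = backward c b (g₃ + g₁) b<c (shift₃ a g₁ g₂ w)
    where shift₃ : ∀ a g₁ g₂ w → a + g₁ + g₂ + w + (a + g₁) ≡ a + g₁ + g₂ + (w + a + g₁)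
          shift₃ = solve-∀

positive-gap : ∀ {x y} → x < y → Σ ℕ λ g → 1 ≤ g × y ≡ x + g
positive-gap {x} {y} x<y = y ∸ x , m<n⇒0<n∸m x<y , sym (m+[n∸m]≡n (<⇒≤ x<y))

weight3-increasing : ∀ d a b c → a < b → b < c → c < d → weight3 d a b c ≡ 3
weight3-increasing d a b c a<b b<c c<d with positive-gap a<b | positive-gap b<c | positive-gap c<d
... | g₁ , 1≤g₁ , refl | g₂ , 1≤g₂ , refl | w , 1≤w , refl = weight3-gaps a g₁ g₂ w 1≤g₁ 1≤g₂ 1≤w

ord-weight3 : ∀ d a b c → c < d → ord a b c * weight3 d a b c ≡ 3 * ord a b c
ord-weight3 d a b c c<d with a <? b | b <? c
... | yes a<b | yes b<c = trans (+-identityʳ _) (weight3-increasing d a b c a<b b<c c<d)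
... | yes _   | no _    = refl
... | no _    | _       = refl

weight-support : ∀ d B C → 1 ≤ d → ¬ (weight d B C ≡ 0) → 1 ≤ B × B < C
weight-support d B C 1≤d w≢0 with 1 ≤? B | 2 * B ≤? C | B + C <? d | 3 * B ≟ d | C ≟ 2 * B
... | yes 1≤B | yes 2B≤C | yes _ | _ | _ = 1≤B , <-≤-trans (B<2B 1≤B) 2B≤C
  where
  B<2B : 1 ≤ B → B < 2 * B
  B<2B h = subst (B <_) (cong (λ t → B + t) (sym (+-identityʳ B))) (m<m+n B h)
... | _ | _ | _ | yes 3B≡d | yes refl = 1≤B , subst (B <_) (cong (λ t → B + t) (sym (+-identityʳ B))) (m<m+n B 1≤B)
  where
  1≤B : 1 ≤ B
  1≤B = n≢0⇒n>0 (λ B≡0 → n>0⇒n≢0 1≤d (trans (sym 3B≡d) (cong (3 *_) B≡0)))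
... | no _  | _     | _     | no _  | _    = ⊥-elim (w≢0 refl)
... | no _  | _     | _     | yes _ | no _ = ⊥-elim (w≢0 refl)
... | yes _ | no _  | _     | no _  | _    = ⊥-elim (w≢0 refl)
... | yes _ | no _  | _     | yes _ | no _ = ⊥-elim (w≢0 refl)
... | yes _ | yes _ | no _  | no _  | _    = ⊥-elim (w≢0 refl)
... | yes _ | yes _ | no _  | yes _ | no _ = ⊥-elim (w≢0 refl)

rotations-abc : ∀ {a b c} → a < b → b < c → ord a b c + ord c a b + ord b c a ≡ 1
rotations-abc {a} {b} {c} a<b b<c
  rewrite ⌊⌋-true (a <? b) a<b | ⌊⌋-true (b <? c) b<c
        | ⌊⌋-false (c <? a) (<⇒≯ (<-trans a<b b<c)) = refl

rotations-cab : ∀ {a b c} → c < a → a < b → ord a b c + ord c a b + ord b c a ≡ 1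
rotations-cab {a} {b} {c} c<a a<b
  rewrite ⌊⌋-true (a <? b) a<b | ⌊⌋-false (b <? c) (<⇒≯ (<-trans c<a a<b))
        | ⌊⌋-true (c <? a) c<a = refl

rotations-bca : ∀ {a b c} → b < c → c < a → ord a b c + ord c a b + ord b c a ≡ 1
rotations-bca {a} {b} {c} b<c c<a
  rewrite ⌊⌋-false (a <? b) (<⇒≯ (<-trans b<c c<a)) | ⌊⌋-true (b <? c) b<c
        | ⌊⌋-true (c <? a) c<a = refl

cyclic-order : ∀ d a b c → c < d → 1 ≤ δ d a b → δ d a b < δ d a c →
  ord a b c + ord c a b + ord b c a ≡ 1
cyclic-order d a b c c<d 1≤δab δab<δac with ≤-<-connex a b | ≤-<-connex a c
... | inj₁ a≤b | inj₁ a≤c = rotations-abc (a<b a≤b)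
        (∸-cancelʳ-<′ {o = a} (subst₂ _<_ (δ-≤ d a b a≤b) (δ-≤ d a c a≤c) δab<δac))
  where
  a<b : a ≤ b → a < b
  a<b a≤b = m∸n≢0⇒n<m (n>0⇒n≢0 (subst (1 ≤_) (δ-≤ d a b a≤b) 1≤δab))
... | inj₁ a≤b | inj₂ c<a = rotations-cab c<a
        (m∸n≢0⇒n<m (n>0⇒n≢0 (subst (1 ≤_) (δ-≤ d a b a≤b) 1≤δab)))
... | inj₂ b<a | inj₁ a≤c = ⊥-elim (<-asym δab<δac δac<δab)
  where
  δac<δab : δ d a c < δ d a b
  δac<δab = subst₂ _<_ (sym (δ-≤ d a c a≤c)) (sym (δ-> d a b b<a))
                   (∸-monoˡ-< (≤-trans c<d (m≤m+n d b)) a≤c)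
... | inj₂ b<a | inj₂ c<a = rotations-bca
        (+-cancelˡ-< d b c (∸-cancelʳ-<′ {o = a} (subst₂ _<_ (δ-> d a b b<a) (δ-> d a c c<a) δab<δac)))
        c<a

-- Hence weightAt, which is supported on such triples, is counted exactly
-- once by the three increasing rotations.
weight-rotations : ∀ d a b c → c < d →
  weightAt d a b c * (ord a b c + ord c a b + ord b c a) ≡ weightAt d a b c
weight-rotations d a b c c<d with weightAt d a b c ≟ 0
... | yes w≡0 = trans (cong (_* (ord a b c + ord c a b + ord b c a)) w≡0) (sym w≡0)
... | no w≢0  = trans (cong (weightAt d a b c *_) (cyclic-order d a b c c<d 1≤δab δab<δac))
                      (*-identityʳ _)
  where
  support = weight-support d (δ d a b) (δ d a c) (≤-trans (s≤s z≤n) c<d) w≢0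
  1≤δab = proj₁ support
  δab<δac = proj₂ support

-- Splitting the weighted sum Σ_{b,c} Z b c · weight d b c into the part
-- of weight 3, which becomes A_d after writing c = b + j, and the
-- balanced part, which is B_d when 3 ∣ d and empty otherwise.

leading : ℕ → ℕ → ℕ → ℕ
leading d b c = [ ⌊ 1 ≤? b ⌋ ] * [ ⌊ 2 * b ≤? c ⌋ ] * [ ⌊ b + c <? d ⌋ ]

balanced : ℕ → ℕ → ℕ → ℕ
balanced d b c = [ ⌊ 3 * b ≟ d ⌋ ] * [ ⌊ c ≟ 2 * b ⌋ ]

Acond : ℕ → ℕ → ℕ → ℕ
Acond d i j = [ ⌊ 1 ≤? i ⌋ ] * [ ⌊ i ≤? j ⌋ ] * [ ⌊ j + 2 * i + 1 ≤? d ⌋ ]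

Asum : ℕ → (ℕ → ℕ → ℕ) → ℕ
Asum d Z = Σℕ d λ i → Σℕ d λ j → Acond d i j * Z i (i + j)

Bsum : ℕ → (ℕ → ℕ → ℕ) → ℕ
Bsum d Z = Σℕ d λ b → Σℕ d λ c → Z b c * balanced d b c

Σweight-split : ∀ d (Z : ℕ → ℕ → ℕ) →
  Σℕ d (λ b → Σℕ d (λ c → Z b c * weight d b c))
  ≡ 3 * Σℕ d (λ b → Σℕ d (λ c → Z b c * leading d b c)) + Bsum d Z
Σweight-split d Z = begin
  Σℕ d (λ b → Σℕ d (λ c → Z b c * weight d b c))
    ≡⟨ Σ-ext d (λ b → Σ-ext d (λ c → distrib (Z b c) (leading d b c) (balanced d b c))) ⟩
  Σℕ d (λ b → Σℕ d (λ c → 3 * (Z b c * leading d b c) + Z b c * balanced d b c))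
    ≡⟨ trans (Σ-ext d (λ b → Σ-+ d _ _)) (Σ-+ d _ _) ⟩
  Σℕ d (λ b → Σℕ d (λ c → 3 * (Z b c * leading d b c))) + Bsum d Z
    ≡⟨ cong (_+ Bsum d Z) (trans (Σ-ext d (λ b → Σ-*ˡ d 3 _)) (Σ-*ˡ d 3 _)) ⟩
  3 * Σℕ d (λ b → Σℕ d (λ c → Z b c * leading d b c)) + Bsum d Z ∎
  where
  distrib : ∀ z x y → z * (3 * x + y) ≡ 3 * (z * x) + z * y
  distrib = solve-∀

leading-diagonal : ∀ d i j → leading d i (j + i) ≡ Acond d i j
leading-diagonal d i j = cong₂ (λ u v → [ ⌊ 1 ≤? i ⌋ ] * [ u ] * [ v ])
  (⌊⌋-⇔ (2 * i ≤? j + i) (i ≤? j)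
        (λ h → +-cancelʳ-≤ i i j (subst (_≤ j + i) 2i≡i+i h))
        (λ h → subst (_≤ j + i) (sym 2i≡i+i) (+-monoˡ-≤ i h)))
  (⌊⌋-⇔ (i + (j + i) <? d) (j + 2 * i + 1 ≤? d)
        (subst (_≤ d) (reorder i j)) (subst (_≤ d) (sym (reorder i j))))
  where
  2i≡i+i : 2 * i ≡ i + i
  2i≡i+i = cong (λ t → i + t) (+-identityʳ i)
  reorder : ∀ i j → suc (i + (j + i)) ≡ j + 2 * i + 1
  reorder = solve-∀

leading-wrapped : ∀ d .{{_ : NonZero d}} i j → i < d → j < d → d ≤ j + i →
  leading d i ((j + i) % d) ≡ 0 × Acond d i j ≡ 0
leading-wrapped d i j i<d j<d d≤j+i = leading≡0 , Acond≡0
  where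
  r = j + i ∸ d
  r<i : r < i
  r<i = subst (r <_) (m+n∸m≡n d i) (∸-monoˡ-< (+-monoˡ-< i j<d) d≤j+i)
  r<d : r < d
  r<d = <-trans r<i i<d
  j+i<j+2i+1 : j + i < j + 2 * i + 1
  j+i<j+2i+1 = subst (j + i <_) (reorder j i) (s≤s (+-monoʳ-≤ j (m≤m+n i (i + 0))))
    where
    reorder : ∀ j i → suc (j + (i + (i + 0))) ≡ j + 2 * i + 1
    reorder = solve-∀
  leading≡0 : leading d i ((j + i) % d) ≡ 0
  leading≡0 rewrite %-wrap d (j + i) d≤j+i r<d
                  | ⌊⌋-false (2 * i ≤? r) (<⇒≱ (<-≤-trans r<i (m≤m+n i (i + 0)))) =
    cong (_* [ ⌊ i + r <? d ⌋ ]) (*-zeroʳ [ ⌊ 1 ≤? i ⌋ ])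
  Acond≡0 : Acond d i j ≡ 0
  Acond≡0 rewrite ⌊⌋-false (j + 2 * i + 1 ≤? d) (<⇒≱ (≤-<-trans d≤j+i j+i<j+2i+1)) =
    *-zeroʳ ([ ⌊ 1 ≤? i ⌋ ] * [ ⌊ i ≤? j ⌋ ])

Σleading≡Asum : ∀ d .{{_ : NonZero d}} (Z : ℕ → ℕ → ℕ) →
  Σℕ d (λ b → Σℕ d (λ c → Z b c * leading d b c)) ≡ Asum d Z
Σleading≡Asum d Z = Σ-cong d row
  where
  point : ∀ i j → i < d → j < d →
    Z i ((j + i) % d) * leading d i ((j + i) % d) ≡ Acond d i j * Z i (i + j)
  point i j i<d j<d with j + i <? d
  ... | yes j+i<d = begin
    Z i ((j + i) % d) * leading d i ((j + i) % d)
      ≡⟨ cong (λ c → Z i c * leading d i c) (m<n⇒m%n≡m j+i<d) ⟩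
    Z i (j + i) * leading d i (j + i) ≡⟨ cong₂ _*_ (cong (Z i) (+-comm j i)) (leading-diagonal d i j) ⟩
    Z i (i + j) * Acond d i j         ≡⟨ *-comm (Z i (i + j)) _ ⟩
    Acond d i j * Z i (i + j)         ∎
  ... | no j+i≮d = begin
    Z i ((j + i) % d) * leading d i ((j + i) % d) ≡⟨ cong (Z i ((j + i) % d) *_) (proj₁ vanish) ⟩
    Z i ((j + i) % d) * 0                         ≡⟨ *-zeroʳ (Z i ((j + i) % d)) ⟩
    0                                             ≡⟨ cong (_* Z i (i + j)) (sym (proj₂ vanish)) ⟩
    Acond d i j * Z i (i + j)                     ∎
    where
    vanish = leading-wrapped d i j i<d j<d (≮⇒≥ j+i≮d)
  row : ∀ i → i < d → Σℕ d (λ c → Z i c * leading d i c) ≡ Σℕ d (λ j → Acond d i j * Z i (i + j))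
  row i i<d = trans (sym (Σ-rotate d i (λ c → Z i c * leading d i c))) (Σ-cong d (λ j → point i j i<d))

balanced-row : ∀ d (Z : ℕ → ℕ → ℕ) b → 1 ≤ d →
  Σℕ d (λ c → Z b c * balanced d b c) ≡ [ ⌊ 3 * b ≟ d ⌋ ] * Z b (2 * b)
balanced-row d Z b 1≤d with 3 * b ≟ d
... | no _      = trans (Σ-ext d (λ c → *-zeroʳ (Z b c))) (Σ-zero d)
... | yes 3b≡d = begin
  Σℕ d (λ c → Z b c * ([ ⌊ c ≟ 2 * b ⌋ ] + 0)) ≡⟨ Σ-ext d (λ c → cong (Z b c *_) (+-identityʳ _)) ⟩
  Σℕ d (λ c → Z b c * [ ⌊ c ≟ 2 * b ⌋ ])       ≡⟨ Σ-pickʳ d (2 * b) (Z b) 2b<d ⟩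
  Z b (2 * b)                                  ≡⟨ sym (+-identityʳ _) ⟩
  Z b (2 * b) + 0                              ∎
  where
  1≤b : 1 ≤ b
  1≤b = n≢0⇒n>0 (λ b≡0 → n>0⇒n≢0 1≤d (trans (sym 3b≡d) (cong (3 *_) b≡0)))
  2b<d : 2 * b < d
  2b<d = subst (2 * b <_) (trans (thrice b) 3b≡d) (m<n+m (2 * b) 1≤b)
    where
    thrice : ∀ b → b + 2 * b ≡ 3 * b
    thrice = solve-∀

Bsum-divisible : ∀ d (Z : ℕ → ℕ → ℕ) → 1 ≤ d → d % 3 ≡ 0 →
  Bsum d Z ≡ Z (d / 3) (2 * (d / 3))
Bsum-divisible d Z 1≤d d%3≡0 = begin
  Bsum d Z ≡⟨ Σ-ext d (λ b → balanced-row d Z b 1≤d) ⟩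
  Σℕ d (λ b → [ ⌊ 3 * b ≟ d ⌋ ] * Z b (2 * b))
    ≡⟨ Σ-ext d (λ b → cong (λ x → [ x ] * Z b (2 * b))
                          (⌊⌋-⇔ (3 * b ≟ d) (t ≟ b) (third b) (λ t≡b → trans (cong (3 *_) (sym t≡b)) (sym d≡3t)))) ⟩
  Σℕ d (λ b → [ ⌊ t ≟ b ⌋ ] * Z b (2 * b)) ≡⟨ Σ-pick d t (λ b → Z b (2 * b)) t<d ⟩
  Z t (2 * t) ∎
  where
  t = d / 3
  d≡3t : d ≡ 3 * t
  d≡3t = trans (m≡m%n+[m/n]*n d 3) (trans (cong (_+ t * 3) d%3≡0) (*-comm t 3))
  third : ∀ b → 3 * b ≡ d → t ≡ b
  third b e = *-cancelˡ-≡ t b 3 (trans (sym d≡3t) (sym e))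
  t<d : t < d
  t<d = subst (t <_) (sym d≡3t) (m<m+n t (≤-trans 1≤t (m≤m+n t (t + 0))))
    where
    1≤t : 1 ≤ t
    1≤t = n≢0⇒n>0 (λ t≡0 → n>0⇒n≢0 1≤d (trans d≡3t (cong (3 *_) t≡0)))

Bsum-indivisible : ∀ d (Z : ℕ → ℕ → ℕ) → 1 ≤ d → ¬ (d % 3 ≡ 0) → Bsum d Z ≡ 0
Bsum-indivisible d Z 1≤d d%3≢0 = begin
  Bsum d Z ≡⟨ Σ-ext d (λ b → balanced-row d Z b 1≤d) ⟩
  Σℕ d (λ b → [ ⌊ 3 * b ≟ d ⌋ ] * Z b (2 * b))
    ≡⟨ Σ-ext d (λ b → cong (λ x → [ x ] * Z b (2 * b)) (⌊⌋-false (3 * b ≟ d) (not-multiple b))) ⟩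
  Σℕ d (λ _ → 0) ≡⟨ Σ-zero d ⟩
  0 ∎
  where
  not-multiple : ∀ b → ¬ (3 * b ≡ d)
  not-multiple b 3b≡d = d%3≢0 (trans (cong (_% 3) (sym 3b≡d))
                                     (trans (cong (_% 3) (*-comm 3 b)) (m*n%n≡0 b 3)))

-- Elements of ℤ[x]/(x^p - 1) with natural-number
-- coefficients are multiplied by convolution, so the coefficient of x^k
-- in η_a η_b η_c is N a b c k, and that of x^k in e3 is
-- E3 k = Σ_{a<b<c<d} N a b c k.

Σℤ-ext : ∀ n {f h : ℕ → ℤ} → (∀ i → f i ≡ h i) → Σℤ n f ≡ Σℤ n h
Σℤ-ext zero    eq = refl
Σℤ-ext (suc n) eq = cong₂ ℤ._+_ (Σℤ-ext n eq) (eq n)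

Σℤ-+ : ∀ n (f : ℕ → ℕ) → Σℤ n (λ i → + f i) ≡ + Σℕ n f
Σℤ-+ zero    f = refl
Σℤ-+ (suc n) f = trans (cong (ℤ._+ + f n) (Σℤ-+ n f)) (sym (ℤP.pos-+ (Σℕ n f) (f n)))

if-+ : ∀ b x → (if b then + x else + 0) ≡ + ([ b ] * x)
if-+ true  x = cong +_ (sym (+-identityʳ x))
if-+ false x = refl

Σ-fibres : ∀ P M (H : ℕ → ℕ → ℕ) (φ : ℕ → ℕ) →
  Σℕ P (λ i → Σℕ M (λ s → H s i) * φ i) ≡ Σℕ M (λ s → Σℕ P (λ i → H s i * φ i))
Σ-fibres P M H φ = trans (Σ-ext P (λ i → sym (Σ-*ʳ M (φ i) (λ s → H s i)))) (Σ-swap P M _)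

module PeriodProducts (q g d m : ℕ) {{_ : NonZero d}} {{_ : NonZero m}}
       (g^q≡1 : g ^ q % suc q ≡ 1) (q≡md : q ≡ m * d) (m≡mOf : m ≡ mOf (suc q) d) where
  open Classes q g d m g^q≡1 q≡md

  ηcount : ℕ → ℕ → ℕ
  ηcount j k = Σℕ m (λ s → [ ⌊ cls j s ≟ k ⌋ ])

  η≡ηcount : ∀ j k → η (suc q) d g j k ≡ + ηcount j k
  η≡ηcount j k = cong +_ (trans (Σlist-upTo (mOf (suc q) d) _ _)
                                (cong (λ t → Σℕ t (λ s → [ ⌊ cls j s ≟ k ⌋ ])) (sym m≡mOf)))

  conv : (ℕ → ℕ) → (ℕ → ℕ) → ℕ → ℕ
  conv f h k = Σℕ P (λ i → Σℕ P (λ j → [ ⌊ (i + j) % P ≟ k ⌋ ] * (f i * h j)))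

  mul≡conv : ∀ (f h : ℕ → ℕ) {f' h' : ℕ → ℤ} → (∀ i → f' i ≡ + f i) → (∀ i → h' i ≡ + h i) →
    ∀ k → mul (suc q) f' h' k ≡ + conv f h k
  mul≡conv f h {f'} {h'} f'≡f h'≡h k = begin
    mul (suc q) f' h' k
      ≡⟨ Σℤ-ext P (λ i → Σℤ-ext P (λ j → cong₂ (λ x y → if ⌊ (i + j) % P ≟ k ⌋ then x ℤ.* y else + 0)
                                                 (f'≡f i) (h'≡h j))) ⟩
    Σℤ P (λ i → Σℤ P (λ j → if ⌊ (i + j) % P ≟ k ⌋ then + f i ℤ.* + h j else + 0))
      ≡⟨ Σℤ-ext P (λ i → Σℤ-ext P (λ j → trans (cong (λ x → if ⌊ (i + j) % P ≟ k ⌋ then x else + 0)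
                                                       (sym (ℤP.pos-* (f i) (h j))))
                                                 (if-+ _ (f i * h j)))) ⟩
    Σℤ P (λ i → Σℤ P (λ j → + ([ ⌊ (i + j) % P ≟ k ⌋ ] * (f i * h j))))
      ≡⟨ trans (Σℤ-ext P (λ i → Σℤ-+ P _)) (Σℤ-+ P _) ⟩
    + conv f h k ∎

  conv-class : ∀ (f : ℕ → ℕ) c k →
    conv f (ηcount c) k ≡ Σℕ P (λ i → f i * Σℕ m (λ u → [ ⌊ (i + cls c u) % P ≟ k ⌋ ]))
  conv-class f c k = Σ-ext P λ i → begin
    Σℕ P (λ j → [ ⌊ (i + j) % P ≟ k ⌋ ] * (f i * ηcount c j))
      ≡⟨ Σ-ext P (λ j → rearrange _ (f i) (ηcount c j)) ⟩
    Σℕ P (λ j → f i * (ηcount c j * [ ⌊ (i + j) % P ≟ k ⌋ ]))   ≡⟨ Σ-*ˡ P (f i) _ ⟩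
    f i * Σℕ P (λ j → ηcount c j * [ ⌊ (i + j) % P ≟ k ⌋ ])
      ≡⟨ cong (f i *_) (trans (Σ-fibres P m (λ u j → [ ⌊ cls c u ≟ j ⌋ ]) _)
           (Σ-ext m (λ u → Σ-pick P (cls c u) (λ j → [ ⌊ (i + j) % P ≟ k ⌋ ]) (gpow<P (u * d + c))))) ⟩
    f i * Σℕ m (λ u → [ ⌊ (i + cls c u) % P ≟ k ⌋ ]) ∎
    where
    rearrange : ∀ x y z → x * (y * z) ≡ y * (z * x)
    rearrange = solve-∀

  N₂′ : ℕ → ℕ → ℕ → ℕ
  N₂′ a b k = Σℕ m (λ s → Σℕ m (λ t → [ ⌊ (cls a s + cls b t) % P ≟ k ⌋ ]))

  conv-pair : ∀ a b k → conv (ηcount a) (ηcount b) k ≡ N₂′ a b k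
  conv-pair a b k = trans (conv-class (ηcount a) b k)
    (trans (Σ-fibres P m (λ s i → [ ⌊ cls a s ≟ i ⌋ ]) _)
           (Σ-ext m (λ s → Σ-pick P (cls a s) (λ i → Σℕ m (λ u → [ ⌊ (i + cls b u) % P ≟ k ⌋ ]))
                                    (gpow<P (s * d + a)))))

  conv-triple : ∀ a b c k → conv (N₂′ a b) (ηcount c) k ≡ N a b c k
  conv-triple a b c k = begin
    conv (N₂′ a b) (ηcount c) k          ≡⟨ conv-class (N₂′ a b) c k ⟩
    Σℕ P (λ i → N₂′ a b i * ψ i)
      ≡⟨ Σ-fibres P m (λ s i → Σℕ m (λ t → [ ⌊ (cls a s + cls b t) % P ≟ i ⌋ ])) ψ ⟩
    Σℕ m (λ s → Σℕ P (λ i → Σℕ m (λ t → [ ⌊ (cls a s + cls b t) % P ≟ i ⌋ ]) * ψ i))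
      ≡⟨ Σ-ext m (λ s → trans (Σ-fibres P m (λ t i → [ ⌊ (cls a s + cls b t) % P ≟ i ⌋ ]) ψ)
                              (Σ-ext m (λ t → Σ-pick P _ ψ (m%n<n (cls a s + cls b t) P)))) ⟩
    Σℕ m (λ s → Σℕ m (λ t → ψ ((cls a s + cls b t) % P)))
      ≡⟨ Σ-ext m (λ s → Σ-ext m (λ t → Σ-ext m (λ u →
           cong (λ r → [ ⌊ r ≟ k ⌋ ]) ([m%n+o]%n≡[m+o]%n (cls a s + cls b t) (cls c u) P)))) ⟩
    N a b c k ∎
    where
    ψ : ℕ → ℕ
    ψ i = Σℕ m (λ u → [ ⌊ (i + cls c u) % P ≟ k ⌋ ])

  η-product : ∀ a b c k →
    mul (suc q) (mul (suc q) (η (suc q) d g a) (η (suc q) d g b)) (η (suc q) d g c) k ≡ + N a b c k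
  η-product a b c k = trans
    (mul≡conv (N₂′ a b) (ηcount c)
              (λ i → trans (mul≡conv (ηcount a) (ηcount b) (η≡ηcount a) (η≡ηcount b) i)
                           (cong +_ (conv-pair a b i)))
              (η≡ηcount c) k)
    (cong +_ (conv-triple a b c k))

  E3 : ℕ → ℕ
  E3 k = Σ3 d (λ a b c → ord a b c * N a b c k)

  e3≡E3 : ∀ k → e3 (suc q) d g k ≡ + E3 k
  e3≡E3 k = begin
    e3 (suc q) d g k
      ≡⟨ Σℤ-ext d (λ a → Σℤ-ext d (λ b → Σℤ-ext d (λ c →
           trans (cong (λ x → if ⌊ a <? b ⌋ ∧ ⌊ b <? c ⌋ then x else + 0) (η-product a b c k))
                 (if-+ _ (N a b c k))))) ⟩
    Σℤ d (λ a → Σℤ d (λ b → Σℤ d (λ c → + (ord a b c * N a b c k))))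
      ≡⟨ trans (Σℤ-ext d (λ a → trans (Σℤ-ext d (λ b → Σℤ-+ d _)) (Σℤ-+ d _))) (Σℤ-+ d _) ⟩
    + E3 k ∎

-- The number of increasing triples a < b < c < d is d·C(d-1, 2)/3:
-- sum over the middle element b of b·(d-1-b), then closed forms.

[∧]≡[]*[] : ∀ x y → [ x ∧ y ] ≡ [ x ] * [ y ]
[∧]≡[]*[] true  true  = refl
[∧]≡[]*[] true  false = refl
[∧]≡[]*[] false y     = refl

count-above : ∀ d b → Σℕ d (λ c → lt b c) ≡ d ∸ suc b
count-above zero    b = refl
count-above (suc d) b with b <? d
... | yes b<d = begin
  Σℕ d (λ c → lt b c) + 1 ≡⟨ cong (_+ 1) (count-above d b) ⟩
  d ∸ suc b + 1           ≡⟨ +-comm (d ∸ suc b) 1 ⟩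
  suc (d ∸ suc b)         ≡⟨ sym (+-∸-assoc 1 b<d) ⟩
  suc d ∸ suc b           ∎
... | no b≮d = begin
  Σℕ d (λ c → lt b c) + 0 ≡⟨ +-identityʳ _ ⟩
  Σℕ d (λ c → lt b c)     ≡⟨ count-above d b ⟩
  d ∸ suc b               ≡⟨ m≤n⇒m∸n≡0 (≤-trans (≮⇒≥ b≮d) (n≤1+n b)) ⟩
  0                       ≡⟨ sym (m≤n⇒m∸n≡0 (≮⇒≥ b≮d)) ⟩
  suc d ∸ suc b           ∎

count-below : ∀ d b → Σℕ d (λ a → lt a b) ≡ d ⊓ b
count-below zero    b = refl
count-below (suc d) b with d <? b
... | yes d<b = begin
  Σℕ d (λ a → lt a b) + 1 ≡⟨ cong (_+ 1) (count-below d b) ⟩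
  d ⊓ b + 1               ≡⟨ cong (_+ 1) (m≤n⇒m⊓n≡m (<⇒≤ d<b)) ⟩
  d + 1                   ≡⟨ +-comm d 1 ⟩
  suc d                   ≡⟨ sym (m≤n⇒m⊓n≡m d<b) ⟩
  suc d ⊓ b               ∎
... | no d≮b = begin
  Σℕ d (λ a → lt a b) + 0 ≡⟨ +-identityʳ _ ⟩
  Σℕ d (λ a → lt a b)     ≡⟨ count-below d b ⟩
  d ⊓ b                   ≡⟨ m≥n⇒m⊓n≡n (≮⇒≥ d≮b) ⟩
  b                       ≡⟨ sym (m≥n⇒m⊓n≡n (≤-trans (≮⇒≥ d≮b) (n≤1+n d))) ⟩
  suc d ⊓ b               ∎

Σ-middle : ℕ → ℕ
Σ-middle d = Σℕ d (λ b → b * (d ∸ suc b))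

increasing-by-middle : ∀ d → Σ3 d ord ≡ Σ-middle d
increasing-by-middle d = begin
  Σ3 d ord
    ≡⟨ Σ-ext d (λ a → Σ-ext d (λ b → trans (Σ-ext d (λ c → [∧]≡[]*[] ⌊ a <? b ⌋ ⌊ b <? c ⌋))
                                           (Σ-*ˡ d (lt a b) (λ c → lt b c)))) ⟩
  Σℕ d (λ a → Σℕ d (λ b → lt a b * Σℕ d (λ c → lt b c)))
    ≡⟨ Σ-ext d (λ a → Σ-ext d (λ b → cong (lt a b *_) (count-above d b))) ⟩
  Σℕ d (λ a → Σℕ d (λ b → lt a b * (d ∸ suc b))) ≡⟨ Σ-swap d d _ ⟩
  Σℕ d (λ b → Σℕ d (λ a → lt a b * (d ∸ suc b)))
    ≡⟨ Σ-cong d (λ b b<d → trans (Σ-*ʳ d _ (λ a → lt a b))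
                                 (cong (_* (d ∸ suc b)) (trans (count-below d b) (m≥n⇒m⊓n≡n (<⇒≤ b<d))))) ⟩
  Σ-middle d ∎

triangle : ℕ → ℕ
triangle d = Σℕ d (λ b → b)

triangle-closed : ∀ d → 2 * triangle d + d ≡ d * d
triangle-closed zero    = refl
triangle-closed (suc d) = begin
  2 * (triangle d + d) + suc d ≡⟨ expand (triangle d) d ⟩
  (2 * triangle d + d) + 2 * d + 1 ≡⟨ cong (λ x → x + 2 * d + 1) (triangle-closed d) ⟩
  d * d + 2 * d + 1 ≡⟨ square d ⟩
  suc d * suc d ∎
  where
  expand : ∀ w d → 2 * (w + d) + suc d ≡ (2 * w + d) + 2 * d + 1
  expand = solve-∀
  square : ∀ d → d * d + 2 * d + 1 ≡ suc d * suc d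
  square = solve-∀

Σ-middle-step : ∀ d → Σ-middle (suc d) ≡ Σ-middle d + triangle d
Σ-middle-step d = begin
  Σℕ d (λ b → b * (d ∸ b)) + d * (d ∸ d)
    ≡⟨ cong₂ _+_ (Σ-cong d (λ b b<d → trans (cong (b *_) (split b b<d)) (*-distribˡ-+ b (d ∸ suc b) 1)))
                 (trans (cong (d *_) (n∸n≡0 d)) (*-zeroʳ d)) ⟩
  Σℕ d (λ b → b * (d ∸ suc b) + b * 1) + 0 ≡⟨ +-identityʳ _ ⟩
  Σℕ d (λ b → b * (d ∸ suc b) + b * 1)     ≡⟨ Σ-+ d _ _ ⟩
  Σ-middle d + Σℕ d (λ b → b * 1)          ≡⟨ cong (λ x → Σ-middle d + x) (Σ-ext d *-identityʳ) ⟩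
  Σ-middle d + triangle d                  ∎
  where
  split : ∀ b → b < d → d ∸ b ≡ d ∸ suc b + 1
  split b b<d = trans (+-∸-assoc 1 b<d) (+-comm 1 (d ∸ suc b))

Σ-middle-closed : ∀ d → 6 * Σ-middle d + 3 * (d * d) ≡ d * d * d + 2 * d
Σ-middle-closed zero    = refl
Σ-middle-closed (suc d) = begin
  6 * Σ-middle (suc d) + 3 * (suc d * suc d)
    ≡⟨ cong (λ x → 6 * x + 3 * (suc d * suc d)) (Σ-middle-step d) ⟩
  6 * (Σ-middle d + triangle d) + 3 * (suc d * suc d)
    ≡⟨ regroup (Σ-middle d) (triangle d) d ⟩
  (6 * Σ-middle d + 3 * (d * d)) + 3 * (2 * triangle d + d) + 3 * d + 3
    ≡⟨ cong₂ (λ x y → x + 3 * y + 3 * d + 3) (Σ-middle-closed d) (triangle-closed d) ⟩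
  (d * d * d + 2 * d) + 3 * (d * d) + 3 * d + 3 ≡⟨ cube d ⟩
  suc d * suc d * suc d + 2 * suc d ∎
  where
  regroup : ∀ S W d → 6 * (S + W) + 3 * (suc d * suc d)
                      ≡ (6 * S + 3 * (d * d)) + 3 * (2 * W + d) + 3 * d + 3
  regroup = solve-∀
  cube : ∀ d → (d * d * d + 2 * d) + 3 * (d * d) + 3 * d + 3 ≡ suc d * suc d * suc d + 2 * suc d
  cube = solve-∀

choose2-closed : ∀ e → 2 * (e C 2) + e ≡ e * e
choose2-closed zero    = cong (λ x → 2 * x + 0) (k>n⇒nCk≡0 {0} {2} (s≤s z≤n))
choose2-closed (suc e) = begin
  2 * (suc e C 2) + suc e   ≡⟨ cong (λ x → 2 * x + suc e) (sym (nCk+nC[k+1]≡[n+1]C[k+1] e 1)) ⟩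
  2 * (e C 1 + e C 2) + suc e ≡⟨ cong (λ x → 2 * (x + e C 2) + suc e) (nC1≡n e) ⟩
  2 * (e + e C 2) + suc e   ≡⟨ regroup e (e C 2) ⟩
  (2 * (e C 2) + e) + 2 * e + 1 ≡⟨ cong (λ x → x + 2 * e + 1) (choose2-closed e) ⟩
  e * e + 2 * e + 1         ≡⟨ square e ⟩
  suc e * suc e             ∎
  where
  regroup : ∀ e k → 2 * (e + k) + suc e ≡ (2 * k + e) + 2 * e + 1
  regroup = solve-∀
  square : ∀ e → e * e + 2 * e + 1 ≡ suc e * suc e
  square = solve-∀

choose2-positive : ∀ e → 2 ≤ e → 1 ≤ e C 2
choose2-positive (suc e) (s≤s 1≤e) =
  subst (1 ≤_) (trans (cong (_+ e C 2) (sym (nC1≡n e))) (nCk+nC[k+1]≡[n+1]C[k+1] e 1))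
        (≤-trans 1≤e (m≤m+n e (e C 2)))

increasing-triples : ∀ d → 3 * Σ3 d ord ≡ d * ((d ∸ 1) C 2)
increasing-triples zero    = refl
increasing-triples (suc e) = *-cancelˡ-≡ (3 * T) (d * K) 2 (begin
  2 * (3 * T)    ≡⟨ six T ⟩
  6 * T          ≡⟨ +-cancelʳ-≡ (3 * (d * d)) (6 * T) (d * (2 * K)) cancel-square ⟩
  d * (2 * K)    ≡⟨ swap d K ⟩
  2 * (d * K)    ∎)
  where
  d = suc e
  T = Σ3 d ord
  K = e C 2
  six : ∀ T → 2 * (3 * T) ≡ 6 * T
  six = solve-∀
  swap : ∀ d K → d * (2 * K) ≡ 2 * (d * K)
  swap = solve-∀
  cancel-square : 6 * T + 3 * (d * d) ≡ d * (2 * K) + 3 * (d * d)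
  cancel-square = +-cancelʳ-≡ (d * e) _ _ (begin
    6 * T + 3 * (d * d) + d * e
      ≡⟨ cong (λ x → 6 * x + 3 * (d * d) + d * e) (increasing-by-middle d) ⟩
    6 * Σ-middle d + 3 * (d * d) + d * e  ≡⟨ cong (_+ d * e) (Σ-middle-closed d) ⟩
    d * d * d + 2 * d + d * e             ≡⟨ sym (poly e) ⟩
    d * (e * e) + 3 * (d * d)             ≡⟨ cong (λ x → d * x + 3 * (d * d)) (sym (choose2-closed e)) ⟩
    d * (2 * K + e) + 3 * (d * d)         ≡⟨ expand d K e ⟩
    d * (2 * K) + 3 * (d * d) + d * e     ∎)
    where
    poly : ∀ e → suc e * (e * e) + 3 * (suc e * suc e) ≡ suc e * suc e * suc e + 2 * suc e + suc e * e
    poly = solve-∀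
    expand : ∀ d K e → d * (2 * K + e) + 3 * (d * d) ≡ d * (2 * K) + 3 * (d * d) + d * e
    expand = solve-∀

-- A primitive root modulo P = q' + 2 reaches every nonzero residue: the
-- powers g^0, …, g^(q-1) are nonzero and pairwise distinct, so by the
-- pigeonhole principle they fill all q nonzero residues.

module PrimitiveRoot (q' g : ℕ) (g^q≡1 : g ^ suc q' % suc (suc q') ≡ 1)
       (g-primitive : ∀ k → 0 < k → k < suc q' → ¬ (g ^ k % suc (suc q') ≡ 1)) where
  q = suc q'
  open PowersMod q g g^q≡1

  gpow≢0 : ∀ e → e ≤ q → gpow e ≢ 0
  gpow≢0 e e≤q gpow≡0 = 0≢1+n (begin
    0                             ≡⟨ cong (_% P) (sym (*-zeroʳ (gpow (q ∸ e)))) ⟩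
    (gpow (q ∸ e) * 0) % P        ≡⟨ cong (λ t → (gpow (q ∸ e) * t) % P) (sym gpow≡0) ⟩
    (gpow (q ∸ e) * gpow e) % P   ≡⟨ gpow-inverse e e≤q ⟩
    1                             ∎)

  gpow-injective : ∀ e₁ e₂ → e₁ < e₂ → e₂ < q → gpow e₁ ≢ gpow e₂
  gpow-injective e₁ e₂ e₁<e₂ e₂<q eq =
    g-primitive (e₂ ∸ e₁) (m<n⇒0<n∸m e₁<e₂) (≤-<-trans (m∸n≤m e₂ e₁) e₂<q) (begin
      gpow (e₂ ∸ e₁)                  ≡⟨ sym (gpow-period 1 (e₂ ∸ e₁)) ⟩
      gpow (1 * q + (e₂ ∸ e₁))        ≡⟨ cong gpow exponent ⟩
      gpow ((q ∸ e₁) + e₂)            ≡⟨ sym (gpow-+ (q ∸ e₁) e₂) ⟩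
      (gpow (q ∸ e₁) * gpow e₂) % P   ≡⟨ cong (λ t → (gpow (q ∸ e₁) * t) % P) (sym eq) ⟩
      (gpow (q ∸ e₁) * gpow e₁) % P   ≡⟨ gpow-inverse e₁ e₁≤q ⟩
      1                               ∎)
    where
    e₁≤q : e₁ ≤ q
    e₁≤q = <⇒≤ (<-trans e₁<e₂ e₂<q)
    exponent : 1 * q + (e₂ ∸ e₁) ≡ q ∸ e₁ + e₂
    exponent = begin
      1 * q + (e₂ ∸ e₁) ≡⟨ cong (_+ (e₂ ∸ e₁)) (*-identityˡ q) ⟩
      q + (e₂ ∸ e₁)     ≡⟨ sym (+-∸-assoc q (<⇒≤ e₁<e₂)) ⟩
      q + e₂ ∸ e₁       ≡⟨ cong (_∸ e₁) (+-comm q e₂) ⟩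
      e₂ + q ∸ e₁       ≡⟨ +-∸-assoc e₂ e₁≤q ⟩
      e₂ + (q ∸ e₁)     ≡⟨ +-comm e₂ (q ∸ e₁) ⟩
      q ∸ e₁ + e₂       ∎

  gpow-surjective : ∀ k → 1 ≤ k → k < P → Σ ℕ (λ e → gpow e ≡ k)
  gpow-surjective k 1≤k k<P with FinP.any? {n = q} (λ i → gpow (toℕ i) ≟ k)
  ... | yes (i , gpow-i≡k) = toℕ i , gpow-i≡k
  ... | no missed = ⊥-elim (no-collision (FinP.pigeonhole (n<1+n q') squeeze))
    where
    -- The nonzero residues, shifted down by one, as elements of Fin q.
    1≤gpow : ∀ (i : Fin q) → 1 ≤ gpow (toℕ i)
    1≤gpow i = n≢0⇒n>0 (gpow≢0 (toℕ i) (<⇒≤ (FinP.toℕ<n i)))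
    slot : Fin q → Fin q
    slot i = fromℕ< (∸-monoˡ-< {gpow (toℕ i)} {1} {P} (gpow<P (toℕ i)) (1≤gpow i))
    K : Fin q
    K = fromℕ< (∸-monoˡ-< {k} {1} {P} k<P 1≤k)
    slot-value : ∀ i → toℕ (slot i) + 1 ≡ gpow (toℕ i)
    slot-value i = trans (cong (_+ 1) (FinP.toℕ-fromℕ< _)) (m∸n+n≡m (1≤gpow i))
    avoids : ∀ i → K ≢ slot i
    avoids i K≡slot = missed (i , (begin
      gpow (toℕ i)         ≡⟨ sym (slot-value i) ⟩
      toℕ (slot i) + 1     ≡⟨ cong (λ j → toℕ j + 1) (sym K≡slot) ⟩
      toℕ K + 1            ≡⟨ cong (_+ 1) (FinP.toℕ-fromℕ< _) ⟩
      k ∸ 1 + 1            ≡⟨ m∸n+n≡m 1≤k ⟩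
      k                    ∎))
    -- Avoiding K, the q slots fit into q - 1 places.
    squeeze : Fin q → Fin q'
    squeeze i = Fin.punchOut (avoids i)
    no-collision : (∃ λ i → ∃ λ j → (i Fin.< j) × (squeeze i ≡ squeeze j)) → ⊥
    no-collision (i , j , i<j , same) = gpow-injective (toℕ i) (toℕ j) i<j (FinP.toℕ<n j) (begin
      gpow (toℕ i)     ≡⟨ sym (slot-value i) ⟩
      toℕ (slot i) + 1 ≡⟨ cong (λ l → toℕ l + 1) (FinP.punchOut-injective (avoids i) (avoids j) same) ⟩
      toℕ (slot j) + 1 ≡⟨ slot-value j ⟩
      gpow (toℕ j)     ∎)

module Coefficients (q g d m : ℕ) {{_ : NonZero d}} {{_ : NonZero m}}
       (g^q≡1 : g ^ q % suc q ≡ 1) (q≡md : q ≡ m * d) (m≡mOf : m ≡ mOf (suc q) d)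
       (gpow-surjective : ∀ k → 1 ≤ k → k < suc q → Σ ℕ (λ e → g ^ e % suc q ≡ k)) where
  open Classes q g d m g^q≡1 q≡md
  open PeriodProducts q g d m g^q≡1 q≡md m≡mOf public

  -- (i) Scaling by g rotates the classes, which permutes the distinct
  -- triples (a, b, c); summing over distinct triples is 6 · E3.
  D : ℕ → ℕ
  D k = Σ3 d (λ a b c → distinct a b c * N a b c k)

  D≡6E3 : ∀ k → D k ≡ 6 * E3 k
  D≡6E3 k = SymmetricSum.Σ-distinct d (λ a b c → N a b c k)
              (λ a b c → N-swap₁₂ a b c k) (λ a b c → N-swap₂₃ a b c k)

  D-scale : ∀ k → k < P → D ((gpow 1 * k) % P) ≡ D k
  D-scale k k<P = trans (sym (Σ3-rotate d 1 _)) (Σ3-cong d rotated)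
    where
    rotated : ∀ a b c → a < d → b < d → c < d →
      distinct ((a + 1) % d) ((b + 1) % d) ((c + 1) % d)
        * N ((a + 1) % d) ((b + 1) % d) ((c + 1) % d) ((gpow 1 * k) % P)
      ≡ distinct a b c * N a b c k
    rotated a b c a<d b<d c<d = cong₂ _*_ (distinct-rotate d a b c a<d b<d c<d) (begin
      N ((a + 1) % d) ((b + 1) % d) ((c + 1) % d) ((gpow 1 * k) % P)
        ≡⟨ N-mod₁ (a + 1) _ _ _ ⟩
      N (a + 1) ((b + 1) % d) ((c + 1) % d) ((gpow 1 * k) % P)
        ≡⟨ N-mod₂ (a + 1) (b + 1) _ _ ⟩
      N (a + 1) (b + 1) ((c + 1) % d) ((gpow 1 * k) % P)
        ≡⟨ N-mod₃ (a + 1) (b + 1) (c + 1) _ ⟩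
      N (a + 1) (b + 1) (c + 1) ((gpow 1 * k) % P) ≡⟨ N-scale a b c k k<P ⟩
      N a b c k ∎)

  D-gpow : ∀ e → D (gpow e) ≡ D 1
  D-gpow zero    = cong D (m<n⇒m%n≡m (s≤s 1≤q))
  D-gpow (suc e) = trans (cong D (sym (gpow-+ 1 e))) (trans (D-scale (gpow e) (gpow<P e)) (D-gpow e))

  E3-constant : ∀ k → 1 ≤ k → k < P → E3 k ≡ E3 1
  E3-constant k 1≤k k<P with gpow-surjective k 1≤k k<P
  ... | e , gpow-e≡k = *-cancelˡ-≡ (E3 k) (E3 1) 6 (begin
    6 * E3 k ≡⟨ sym (D≡6E3 k) ⟩
    D k      ≡⟨ cong D (sym gpow-e≡k) ⟩
    D (gpow e) ≡⟨ D-gpow e ⟩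
    D 1      ≡⟨ D≡6E3 1 ⟩
    6 * E3 1 ∎)

  -- (ii) Every triple of C_a × C_b × C_c has exactly one sum.
  ΣN : ∀ a b c → Σℕ P (N a b c) ≡ m * (m * (m * 1))
  ΣN a b c = begin
    Σℕ P (λ k → Σℕ m (λ s → Σℕ m (λ t → Σℕ m (λ u → hit s t u k))))
      ≡⟨ Σ-swap P m _ ⟩
    Σℕ m (λ s → Σℕ P (λ k → Σℕ m (λ t → Σℕ m (λ u → hit s t u k))))
      ≡⟨ Σ-ext m (λ s → trans (Σ-swap P m _) (Σ-ext m (λ t → trans (Σ-swap P m _)
                                                        (Σ-ext m (λ u → one-sum s t u))))) ⟩
    Σℕ m (λ s → Σℕ m (λ t → Σℕ m (λ u → 1)))
      ≡⟨ trans (Σ-ext m (λ s → trans (Σ-ext m (λ t → Σ-const m 1)) (Σ-const m (m * 1)))) (Σ-const m _) ⟩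
    m * (m * (m * 1)) ∎
    where
    hit : ℕ → ℕ → ℕ → ℕ → ℕ
    hit s t u k = [ ⌊ sum3 (cls a s) (cls b t) (cls c u) ≟ k ⌋ ]
    one-sum : ∀ s t u → Σℕ P (hit s t u) ≡ 1
    one-sum s t u = trans (Σ-ext P (λ k → sym (*-identityʳ (hit s t u k))))
      (Σ-pick P (sum3 (cls a s) (cls b t) (cls c u)) (λ _ → 1) (m%n<n (cls a s + cls b t + cls c u) P))

  E3-total : E3 0 + q * E3 1 ≡ Σ3 d ord * (m * (m * (m * 1)))
  E3-total = begin
    E3 0 + q * E3 1
      ≡⟨ cong (λ x → E3 0 + x) (trans (sym (Σ-const q (E3 1)))
           (Σ-cong q (λ k k<q → sym (E3-constant (suc k) (s≤s z≤n) (s≤s k<q))))) ⟩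
    E3 0 + Σℕ q (λ k → E3 (suc k)) ≡⟨ sym (Σ-head q E3) ⟩
    Σℕ P E3
      ≡⟨ trans (Σ-swap P d _) (Σ-ext d (λ a → trans (Σ-swap P d _) (Σ-ext d (λ b → Σ-swap P d _)))) ⟩
    Σ3 d (λ a b c → Σℕ P (λ k → ord a b c * N a b c k))
      ≡⟨ Σ3-cong d (λ a b c _ _ _ → trans (Σ-*ˡ P (ord a b c) _) (cong (ord a b c *_) (ΣN a b c))) ⟩
    Σ3 d (λ a b c → ord a b c * (m * (m * (m * 1))))
      ≡⟨ trans (Σ3-cong d (λ a b c _ _ _ → *-comm (ord a b c) (m * (m * (m * 1)))))
               (Σ3-*ˡ d (m * (m * (m * 1))) ord) ⟩
    (m * (m * (m * 1))) * Σ3 d ord ≡⟨ *-comm _ (Σ3 d ord) ⟩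
    Σ3 d ord * (m * (m * (m * 1))) ∎

  zg : ℕ → ℕ → ℕ
  zg = z (suc q) d g

  zg≡N₂ : ∀ b c → zg b c ≡ N₂ 1 b c 0
  zg≡N₂ b c = begin
    zg b c
      ≡⟨ Σlist-upTo (mOf (suc q) d) (cls b) (λ x → Σlist (Cls (suc q) d g c) (λ y → [ ⌊ sum3 1 x y ≟ 0 ⌋ ])) ⟩
    Σℕ (mOf (suc q) d) (λ t → Σlist (Cls (suc q) d g c) (λ y → [ ⌊ sum3 1 (cls b t) y ≟ 0 ⌋ ]))
      ≡⟨ cong (λ n → Σℕ n (λ t → Σlist (Cls (suc q) d g c) (λ y → [ ⌊ sum3 1 (cls b t) y ≟ 0 ⌋ ]))) (sym m≡mOf) ⟩
    Σℕ m (λ t → Σlist (Cls (suc q) d g c) (λ y → [ ⌊ sum3 1 (cls b t) y ≟ 0 ⌋ ]))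
      ≡⟨ Σ-ext m (λ t → trans (Σlist-upTo (mOf (suc q) d) (cls c) (λ y → [ ⌊ sum3 1 (cls b t) y ≟ 0 ⌋ ]))
                              (cong (λ n → Σℕ n (λ u → [ ⌊ sum3 1 (cls b t) (cls c u) ≟ 0 ⌋ ])) (sym m≡mOf))) ⟩
    N₂ 1 b c 0 ∎

  -- Dividing x + y + w ≡ 0 by the element x ∈ C_0 gives 1 + y' + w' ≡ 0.
  N₀≡mz : ∀ b c → N 0 b c 0 ≡ m * zg b c
  N₀≡mz b c = trans (Σ-ext m normalise) (Σ-const m _)
    where
    normalise : ∀ s → N₂ (cls 0 s) b c 0 ≡ zg b c
    normalise s = begin
      N₂ (gpow (s * d + 0)) b c 0                   ≡⟨ cong (λ x → N₂ (gpow x) b c 0) (+-comm (s * d) 0) ⟩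
      N₂ (gpow (0 + s * d)) b c 0                   ≡⟨ sym (N₂-periodᵇ s (gpow (0 + s * d)) b c 0) ⟩
      N₂ (gpow (0 + s * d)) (b + s * d) c 0         ≡⟨ sym (N₂-periodᶜ s (gpow (0 + s * d)) (b + s * d) c 0) ⟩
      N₂ (gpow (0 + s * d)) (b + s * d) (c + s * d) 0 ≡⟨ N₂-shift (s * d) 0 b c ⟩
      N₂ (gpow 0) b c 0                             ≡⟨ cong (λ x → N₂ x b c 0) (m<n⇒m%n≡m (s≤s 1≤q)) ⟩
      N₂ 1 b c 0                                    ≡⟨ sym (zg≡N₂ b c) ⟩
      zg b c                                        ∎

  relative-term : ∀ a b c → a < d → b < d → c < d →
    N a ((b + a) % d) ((c + a) % d) 0 * weightAt d a ((b + a) % d) ((c + a) % d)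
    ≡ m * zg b c * weight d b c
  relative-term a b c a<d b<d c<d = cong₂ _*_ counts
    (cong₂ (weight d) (δ-relative d a b a<d b<d) (δ-relative d a c a<d c<d))
    where
    counts : N a ((b + a) % d) ((c + a) % d) 0 ≡ m * zg b c
    counts = begin
      N a ((b + a) % d) ((c + a) % d) 0 ≡⟨ N-mod₂ a (b + a) _ 0 ⟩
      N a (b + a) ((c + a) % d) 0       ≡⟨ N-mod₃ a (b + a) (c + a) 0 ⟩
      N a (b + a) (c + a) 0             ≡⟨ sym (cong (λ x → N x (b + a) (c + a) 0) (+-identityˡ a)) ⟩
      N (0 + a) (b + a) (c + a) 0       ≡⟨ N-shift a 0 b c ⟩
      N 0 b c 0                         ≡⟨ N₀≡mz b c ⟩
      m * zg b c                        ∎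

  -- Each increasing triple has total weight 3 over its rotations; moving
  -- the rotations onto (a, b, c) leaves every triple counted with the
  -- weight read from its first point.
  E3-zero-weighted : 3 * E3 0 ≡ Σ3 d (λ a b c → N a b c 0 * weightAt d a b c)
  E3-zero-weighted = begin
    3 * E3 0 ≡⟨ sym (Σ3-*ˡ d 3 _) ⟩
    Σ3 d (λ a b c → 3 * (ord a b c * N a b c 0))
      ≡⟨ Σ3-cong d (λ a b c _ _ c<d → spread a b c c<d) ⟩
    Σ3 d (λ a b c → w₁ a b c + w₂ a b c + w₃ a b c)
      ≡⟨ trans (Σ3-+ d _ w₃) (cong (_+ Σ3 d w₃) (Σ3-+ d w₁ w₂)) ⟩
    Σ3 d w₁ + Σ3 d w₂ + Σ3 d w₃
      ≡⟨ cong₂ _+_ (cong (λ x → Σ3 d w₁ + x) second) third ⟩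
    Σ3 d w₁ + Σ3 d v₂ + Σ3 d v₃
      ≡⟨ sym (trans (Σ3-+ d _ v₃) (cong (_+ Σ3 d v₃) (Σ3-+ d w₁ v₂))) ⟩
    Σ3 d (λ a b c → w₁ a b c + v₂ a b c + v₃ a b c)
      ≡⟨ Σ3-cong d (λ a b c _ _ c<d → trans (collect a b c) (cong (N a b c 0 *_) (weight-rotations d a b c c<d))) ⟩
    Σ3 d (λ a b c → N a b c 0 * weightAt d a b c) ∎
    where
    w₁ w₂ w₃ v₂ v₃ : ℕ → ℕ → ℕ → ℕ
    w₁ a b c = ord a b c * N a b c 0 * weightAt d a b c
    w₂ a b c = ord a b c * N a b c 0 * weightAt d b c a
    w₃ a b c = ord a b c * N a b c 0 * weightAt d c a b
    v₂ a b c = ord c a b * N a b c 0 * weightAt d a b c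
    v₃ a b c = ord b c a * N a b c 0 * weightAt d a b c
    spread : ∀ a b c → c < d → 3 * (ord a b c * N a b c 0) ≡ w₁ a b c + w₂ a b c + w₃ a b c
    spread a b c c<d = begin
      3 * (ord a b c * N a b c 0)   ≡⟨ sym (*-assoc 3 (ord a b c) _) ⟩
      3 * ord a b c * N a b c 0     ≡⟨ cong (_* N a b c 0) (sym (ord-weight3 d a b c c<d)) ⟩
      ord a b c * weight3 d a b c * N a b c 0
        ≡⟨ distrib (ord a b c) (N a b c 0) (weightAt d a b c) (weightAt d b c a) (weightAt d c a b) ⟩
      w₁ a b c + w₂ a b c + w₃ a b c ∎
      where
      distrib : ∀ o n x y w → o * (x + y + w) * n ≡ o * n * x + o * n * y + o * n * w
      distrib = solve-∀
    second : Σ3 d w₂ ≡ Σ3 d v₂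
    second = trans (Σ3-cycle d w₂) (Σ3-cong d (λ a b c _ _ _ →
      cong (λ x → ord c a b * x * weightAt d a b c) (trans (N-swap₁₂ c a b 0) (N-swap₂₃ a c b 0))))
    third : Σ3 d w₃ ≡ Σ3 d v₃
    third = trans (Σ3-cycle² d w₃) (Σ3-cong d (λ a b c _ _ _ →
      cong (λ x → ord b c a * x * weightAt d a b c) (trans (N-swap₂₃ b c a 0) (N-swap₁₂ b a c 0))))
    collect : ∀ a b c → w₁ a b c + v₂ a b c + v₃ a b c
            ≡ N a b c 0 * (weightAt d a b c * (ord a b c + ord c a b + ord b c a))
    collect a b c = factor (ord a b c) (ord c a b) (ord b c a) (N a b c 0) (weightAt d a b c)
      where
      factor : ∀ o₁ o₂ o₃ n x → o₁ * n * x + o₂ * n * x + o₃ * n * x ≡ n * (x * (o₁ + o₂ + o₃))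
      factor = solve-∀

  E3-zero : 3 * E3 0 ≡ d * (m * Σℕ d (λ b → Σℕ d (λ c → zg b c * weight d b c)))
  E3-zero = begin
    3 * E3 0 ≡⟨ E3-zero-weighted ⟩
    Σ3 d (λ a b c → N a b c 0 * weightAt d a b c) ≡⟨ Σ3-relative d _ ⟩
    Σ3 d (λ a b c → N a ((b + a) % d) ((c + a) % d) 0 * weightAt d a ((b + a) % d) ((c + a) % d))
      ≡⟨ Σ3-cong d relative-term ⟩
    Σ3 d (λ a b c → m * zg b c * weight d b c) ≡⟨ Σ-const d _ ⟩
    d * Σℕ d (λ b → Σℕ d (λ c → m * zg b c * weight d b c))
      ≡⟨ cong (d *_) (trans (Σ-ext d (λ b → trans (Σ-ext d (λ c → *-assoc m (zg b c) _)) (Σ-*ˡ d m _)))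
                            (Σ-*ˡ d m _)) ⟩
    d * (m * Σℕ d (λ b → Σℕ d (λ c → zg b c * weight d b c))) ∎

  S K : ℕ
  S = 3 * A (suc q) d g + Bsum d zg
  K = (d ∸ 1) C 2

  weighted≡S : Σℕ d (λ b → Σℕ d (λ c → zg b c * weight d b c)) ≡ S
  weighted≡S = trans (Σweight-split d zg) (cong (λ x → 3 * x + Bsum d zg) (Σleading≡Asum d zg))

  E3-one : 3 * E3 1 + S ≡ K * m * m
  E3-one = *-cancelˡ-≡ _ _ (d * m) {{m*n≢0 d m}} (begin
    d * m * (3 * E3 1 + S)          ≡⟨ split d m (E3 1) S ⟩
    3 * (m * d * E3 1) + d * (m * S) ≡⟨ cong₂ (λ x y → 3 * (x * E3 1) + y) (sym q≡md)
                                             (sym (trans E3-zero (cong (λ x → d * (m * x)) weighted≡S))) ⟩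
    3 * (q * E3 1) + 3 * E3 0        ≡⟨ factor-3 (q * E3 1) (E3 0) ⟩
    3 * (E3 0 + q * E3 1)            ≡⟨ cong (3 *_) E3-total ⟩
    3 * (Σ3 d ord * (m * (m * (m * 1)))) ≡⟨ reassoc (Σ3 d ord) m ⟩
    3 * Σ3 d ord * (m * (m * m))     ≡⟨ cong (_* (m * (m * m))) (increasing-triples d) ⟩
    d * K * (m * (m * m))            ≡⟨ regroup d K m ⟩
    d * m * (K * m * m)              ∎)
    where
    split : ∀ d m e s → d * m * (3 * e + s) ≡ 3 * (m * d * e) + d * (m * s)
    split = solve-∀
    factor-3 : ∀ x y → 3 * x + 3 * y ≡ 3 * (y + x)
    factor-3 = solve-∀
    reassoc : ∀ T m → 3 * (T * (m * (m * (m * 1)))) ≡ 3 * T * (m * (m * m))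
    reassoc = solve-∀
    regroup : ∀ d K m → d * K * (m * (m * m)) ≡ d * m * (K * m * m)
    regroup = solve-∀

  coefficient-identity : 3 * E3 0 + K * m * m ≡ 3 * E3 1 + suc q * S
  coefficient-identity = begin
    3 * E3 0 + K * m * m       ≡⟨ cong₂ _+_ (trans E3-zero (cong (λ x → d * (m * x)) weighted≡S))
                                            (sym E3-one) ⟩
    d * (m * S) + (3 * E3 1 + S) ≡⟨ regroup d m S (E3 1) ⟩
    3 * E3 1 + suc (m * d) * S ≡⟨ cong (λ x → 3 * E3 1 + suc x * S) (sym q≡md) ⟩
    3 * E3 1 + suc q * S       ∎
    where
    regroup : ∀ d m S e → d * (m * S) + (3 * e + S) ≡ 3 * e + suc (m * d) * S
    regroup = solve-∀

  -- All nonzero coefficients of 3 e3 agree, so 3 e3 is the constant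
  -- 3 E3 0 - 3 E3 1 in ℤ[ζ].
  e3-congruence : ∀ c → + (3 * E3 0) ℤ.- c ≡ + (3 * E3 1) →
    scale (+ 3) (e3 (suc q) d g) ≈[ suc q ] const c
  e3-congruence c at-zero = + (3 * E3 1) , coefficient
    where
    scaled : ∀ k → scale (+ 3) (e3 (suc q) d g) k ≡ + (3 * E3 k)
    scaled k = trans (cong (+ 3 ℤ.*_) (e3≡E3 k)) (sym (ℤP.pos-* 3 (E3 k)))
    coefficient : ∀ k → k < suc q → scale (+ 3) (e3 (suc q) d g) k ℤ.- const c k ≡ + (3 * E3 1)
    coefficient zero    _   = trans (cong (ℤ._- c) (scaled 0)) at-zero
    coefficient (suc k) k<p = begin
      scale (+ 3) (e3 (suc q) d g) (suc k) ℤ.- + 0 ≡⟨ ℤP.+-identityʳ _ ⟩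
      scale (+ 3) (e3 (suc q) d g) (suc k)         ≡⟨ scaled (suc k) ⟩
      + (3 * E3 (suc k))                           ≡⟨ cong (λ x → + (3 * x)) (E3-constant (suc k) (s≤s z≤n) k<p) ⟩
      + (3 * E3 1)                                 ∎

ℤ-rearrange : ∀ u v w t → u + w ≡ t + v → + u ℤ.- (+ v ℤ.- + w) ≡ + t
ℤ-rearrange u v w t u+w≡t+v = begin
  + u ℤ.- (+ v ℤ.- + w)      ≡⟨ move (+ u) (+ v) (+ w) ⟩
  (+ u ℤ.+ + w) ℤ.- + v      ≡⟨ cong (ℤ._- + v) (trans (sym (ℤP.pos-+ u w)) (cong +_ u+w≡t+v)) ⟩
  + (t + v) ℤ.- + v          ≡⟨ cong (ℤ._- + v) (ℤP.pos-+ t v) ⟩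
  (+ t ℤ.+ + v) ℤ.- + v      ≡⟨ cancel (+ t) (+ v) ⟩
  + t                        ∎
  where
  move : ∀ (u v w : ℤ) → u ℤ.- (v ℤ.- w) ≡ (u ℤ.+ w) ℤ.- v
  move = ℤSolver.solve-∀
  cancel : ∀ (t v : ℤ) → (t ℤ.+ v) ℤ.- v ≡ t
  cancel = ℤSolver.solve-∀

ℤ-combine : ∀ v₁ w₁ v₂ w₂ → (+ v₁ ℤ.- + w₁) ℤ.+ (+ v₂ ℤ.- + w₂) ≡ + (v₁ + v₂) ℤ.- + (w₁ + w₂)
ℤ-combine v₁ w₁ v₂ w₂ = begin
  (+ v₁ ℤ.- + w₁) ℤ.+ (+ v₂ ℤ.- + w₂)     ≡⟨ regroup (+ v₁) (+ w₁) (+ v₂) (+ w₂) ⟩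
  (+ v₁ ℤ.+ + v₂) ℤ.- (+ w₁ ℤ.+ + w₂)     ≡⟨ sym (cong₂ ℤ._-_ (ℤP.pos-+ v₁ v₂) (ℤP.pos-+ w₁ w₂)) ⟩
  + (v₁ + v₂) ℤ.- + (w₁ + w₂)             ∎
  where
  regroup : ∀ (a b c e : ℤ) → (a ℤ.- b) ℤ.+ (c ℤ.- e) ≡ (a ℤ.+ c) ℤ.- (b ℤ.+ e)
  regroup = ℤSolver.solve-∀

module Proposition (q' d' g k : ℕ) (q≡kd : suc q' ≡ k * suc d')
       (g^q≡1 : g ^ suc q' % suc (suc q') ≡ 1)
       (g-primitive : ∀ e → 0 < e → e < suc q' → ¬ (g ^ e % suc (suc q') ≡ 1)) where
  p = suc (suc q')
  d = suc d'
  m = mOf p d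

  m≡k : m ≡ k
  m≡k = trans (cong (_/ d) q≡kd) (m*n/n≡m k d)

  q≡md : suc q' ≡ m * d
  q≡md = trans q≡kd (cong (_* d) (sym m≡k))

  instance
    m-nonZero : NonZero m
    m-nonZero = ≢-nonZero (λ m≡0 → 0≢1+n (sym (trans q≡md (cong (_* d) m≡0))))

  open Coefficients (suc q') g d m g^q≡1 q≡md refl (PrimitiveRoot.gpow-surjective q' g g^q≡1 g-primitive)

  Aₚ = A p d g

  indivisible : ¬ (d % 3 ≡ 0) →
    scale (+ 3) (e3 p d g) ≈[ p ] const (+ (3 * p * Aₚ) ℤ.- + (K * m * m))
  indivisible d%3≢0 = e3-congruence _ (ℤ-rearrange (3 * E3 0) (3 * p * Aₚ) (K * m * m) (3 * E3 1) (begin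
    3 * E3 0 + K * m * m                ≡⟨ coefficient-identity ⟩
    3 * E3 1 + p * (3 * Aₚ + Bsum d zg) ≡⟨ cong (λ x → 3 * E3 1 + p * (3 * Aₚ + x))
                                                (Bsum-indivisible d zg (s≤s z≤n) d%3≢0) ⟩
    3 * E3 1 + p * (3 * Aₚ + 0)         ≡⟨ cong (λ x → 3 * E3 1 + x) (reorder p Aₚ) ⟩
    3 * E3 1 + 3 * p * Aₚ               ∎))
    where
    reorder : ∀ p a → p * (3 * a + 0) ≡ 3 * p * a
    reorder = solve-∀

  divisible : 3 ≤ d → d % 3 ≡ 0 →
    scale (+ 3) (e3 p d g) ≈[ p ]
      const (+ (3 * p * Aₚ) ℤ.- + ((K ∸ 1) * m * m) ℤ.+ (+ (p * B p d g) ℤ.- + (m * m)))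
  divisible 3≤d d%3≡0 = e3-congruence _ (trans
    (cong (λ x → + (3 * E3 0) ℤ.- x) (ℤ-combine (3 * p * Aₚ) ((K ∸ 1) * m * m) (p * B p d g) (m * m)))
    (ℤ-rearrange (3 * E3 0) (3 * p * Aₚ + p * B p d g) ((K ∸ 1) * m * m + m * m) (3 * E3 1) (begin
      3 * E3 0 + ((K ∸ 1) * m * m + m * m) ≡⟨ cong (λ x → 3 * E3 0 + x) (restore (K ∸ 1) m) ⟩
      3 * E3 0 + suc (K ∸ 1) * m * m       ≡⟨ cong (λ x → 3 * E3 0 + x * m * m) 1+[K∸1]≡K ⟩
      3 * E3 0 + K * m * m                 ≡⟨ coefficient-identity ⟩
      3 * E3 1 + p * (3 * Aₚ + Bsum d zg)  ≡⟨ cong (λ x → 3 * E3 1 + p * (3 * Aₚ + x))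
                                                  (Bsum-divisible d zg (s≤s z≤n) d%3≡0) ⟩
      3 * E3 1 + p * (3 * Aₚ + B p d g)    ≡⟨ cong (λ x → 3 * E3 1 + x) (distrib p Aₚ (B p d g)) ⟩
      3 * E3 1 + (3 * p * Aₚ + p * B p d g) ∎)))
    where
    1+[K∸1]≡K : suc (K ∸ 1) ≡ K
    1+[K∸1]≡K = trans (+-comm 1 (K ∸ 1)) (m∸n+n≡m (choose2-positive (d ∸ 1) (s≤s⁻¹ 3≤d)))
    restore : ∀ k m → k * m * m + m * m ≡ suc k * m * m
    restore = solve-∀
    distrib : ∀ p a b → p * (3 * a + b) ≡ 3 * p * a + p * b
    distrib = solve-∀

proposition14 : (p d g : ℕ) → Prime p → p % 2 ≡ 1 → d ∣ p ∸ 1 → 3 ≤ d →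
    IsPrimitiveRoot p g →
      ((d % 3 ≡ 1) →
        scale (+ 3) (e3 p d g) ≈[ p ]
          const ((+ (3 * p * A p d g)) ℤ.- (+ (((d ∸ 1) C 2) * mOf p d * mOf p d))))
    × ((d % 3 ≡ 2) →
        scale (+ 3) (e3 p d g) ≈[ p ]
          const ((+ (3 * p * A p d g)) ℤ.- (+ (((d ∸ 1) C 2) * mOf p d * mOf p d))))
    × ((d % 3 ≡ 0) →
        scale (+ 3) (e3 p d g) ≈[ p ]
          const ((+ (3 * p * A p d g)) ℤ.- (+ ((((d ∸ 1) C 2) ∸ 1) * mOf p d * mOf p d))
                 ℤ.+ ((+ (p * B p d g)) ℤ.- (+ (mOf p d * mOf p d)))))
proposition14 zero           d        g _ () _ _ _
proposition14 (suc zero)     d        g _ _ _ _ (() , _)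
proposition14 (suc (suc q')) zero     g _ _ _ () _
proposition14 (suc (suc q')) (suc d') g _ _ (divides k q≡kd) 3≤d (g^q≡1 , g-primitive) =
    (λ d%3≡1 → indivisible (λ d%3≡0 → 0≢1+n (trans (sym d%3≡0) d%3≡1)))
  , (λ d%3≡2 → indivisible (λ d%3≡0 → 0≢1+n (trans (sym d%3≡0) d%3≡2)))
  , divisible 3≤d
  where open Proposition q' d' g k q≡kd g^q≡1 g-primitive
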